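{- Let $p$ and $q$ be prime numbers with $q=p+2$, and let $C$ be the curve $y^2=-2x^4+2(p+q)x^2-2$. Then: (1) If $p\equiv1\pmod 8$, then $C(\mathbf{Q}_2)\neq\emptyset$. (2) $C(\mathbf{Q}_p)\neq\emptyset$ if and only if $(-2/p)=1$, i.e. $p\equiv1,3\pmod 8$. (3) $C(\mathbf{Q}_q)\neq\emptyset$ if and only if $(-2/q)=1$, i.e. $q\equiv1,3\pmod 8$ (equivalently $p\equiv1,7\pmod 8$).
   Context: $C(\mathbf{Q}_v)$ denotes the set of points $(x,y)\in\mathbf{Q}_v^2$ satisfying the equation, where $\mathbf{Q}_v$ is the completion of $\mathbf{Q}$ at $v$; $(\cdot/\cdot)$ is the Legendre symbol. -}

module Defs where

open import Data.Nat as ℕ using (ℕ; suc)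
open import Data.Integer as ℤ using (ℤ; +_; _-_; _*_; _+_; -_; _^_)
open import Data.Integer.Divisibility using (_∣_)
open import Data.Product using (Σ; ∃; _×_)
open import Relation.Nullary using (¬_)

-- ℤ_p (for a prime p) as the inverse limit of ℤ/p^nℤ: a sequence of integer
-- representatives x n of residues mod p^n, coherent: x (n+1) ≡ x n (mod p^n).
record ℤ[_] (p : ℕ) : Set where
  field
    digit : ℕ → ℤ
    coherent : ∀ n → ((+ p) ^ n) ∣ (digit (suc n) - digit n)
open ℤ[_] public

-- An element of ℚ_p = ℤ_p[1/p] is written a / p^k with a ∈ ℤ_p, k ∈ ℕ.
record ℚ[_] (p : ℕ) : Set where
  constructor _/p^_
  field
    num : ℤ[ p ]
    expo : ℕ
open ℚ[_] public

-- The curve C_s : y² = -2x⁴ + s x² - 2 (here s = 2(p+q)).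
-- (x , y) = (a / v^k , b / v^l) ∈ ℚ_v² lies on C_s iff, after multiplying by the
-- nonzero element v^(4k+2l), the following identity holds in ℤ_v, i.e. holds
-- modulo v^n for every n (equality in the inverse limit):
--   b² v^(4k) = (-2 a⁴ + s a² v^(2k) - 2 v^(4k)) v^(2l).
CurveEqn : (s : ℤ) (v : ℕ) (A B : ℤ) (k l : ℕ) → ℤ
CurveEqn s v A B k l =
    (B ^ 2) * (V ^ (4 ℕ.* k))
    - ( (- (+ 2)) * (A ^ 4) + s * (A ^ 2) * (V ^ (2 ℕ.* k)) - (+ 2) * (V ^ (4 ℕ.* k)) )
      * (V ^ (2 ℕ.* l))
  where
  V = + v

OnCurve : (s : ℤ) (v : ℕ) → ℚ[ v ] → ℚ[ v ] → Set
OnCurve s v (a /p^ k) (b /p^ l) =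
  ∀ n → ((+ v) ^ n) ∣ CurveEqn s v (digit a n) (digit b n) k l

HasQvPoint : (s : ℤ) (v : ℕ) → Set
HasQvPoint s v = Σ (ℚ[ v ]) λ x → Σ (ℚ[ v ]) λ y → OnCurve s v x y

LegendreOne : ℤ → ℕ → Set
LegendreOne a p = ¬ ((+ p) ∣ a) × ∃ λ (x : ℤ) → (+ p) ∣ (x ^ 2 - a)

module Submission where

-- Write s = 2(p + q). For ℓ ∈ {p, q} one has s = 4ε + 4ℓ with ε = ±1, so that
-- −2x⁴ + s x² − 2 ≡ −2(x² − ε)² modulo ℓ. If −2 is a square modulo ℓ, Hensel's lemma lifts its
-- square root to ℤ_ℓ and (0, √−2) is a point. Conversely, clearing the denominators of a point gives
-- y² ≡ −2(x² − ε)² up to powers of ℓ: either x² − ε is a unit and −2 is a square modulo ℓ, or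
-- ℓ ∣ x² − ε and the right-hand side has odd ℓ-adic valuation. Over ℚ₂, p ≡ 1 (mod 8) makes p a
-- 2-adic square, and (1, 2√p) is a point. Finally (−2/ℓ) is computed by Euler's criterion, proved
-- by pairing every residue with its cofactor (Wilson's theorem is the case a = 1), together with
-- Gauss's count of the numbers among 2, 4, …, ℓ − 1 that exceed (ℓ − 1)/2.

open import Data.Empty using (⊥; ⊥-elim)
open import Data.Fin using (toℕ; fromℕ<)
open import Data.Fin.Properties using (any?; toℕ-fromℕ<)
open import Data.Integer as ℤ using (ℤ; +_; -_; -[1+_]; _+_; _-_; _*_; _^_)
import Data.Integer.DivMod as ℤDM
import Data.Integer.Divisibility as ℤD
open import Data.Integer.Divisibility.Signed
  using (_∣_; divides; _∣?_; ∣ᵤ⇒∣; ∣⇒∣ᵤ; ∣-trans; ∣m∣n⇒∣m+n; ∣m⇒∣-m; ∣n⇒∣m*n; ∣m⇒∣m*n; *-monoˡ-∣; *-cancelˡ-∣)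
import Data.Integer.Properties as ℤP
open import Data.Integer.Tactic.RingSolver using (solve-∀)
open import Data.List using (List; []; _∷_; length; filter; applyUpTo)
open import Data.List.Membership.Propositional using (_∈_)
open import Data.List.Membership.Propositional.Properties using (∈-filter⁺; ∈-filter⁻; ∈-applyUpTo⁺; ∈-applyUpTo⁻)
import Data.List.Properties as ListP
open import Data.List.Relation.Unary.All as All using (All)
open import Data.List.Relation.Unary.All.Properties using (All¬⇒¬Any)
open import Data.List.Relation.Unary.AllPairs as AllPairs using (_∷_)
open import Data.List.Relation.Unary.Any using (here; there)
open import Data.List.Relation.Unary.Unique.Propositional using (Unique)
import Data.List.Relation.Unary.Unique.Propositional.Properties as UniqueP
open import Data.Nat as ℕ using (ℕ; zero; suc; z≤n; s≤s)
open import Data.Nat.Coprimality using (Coprime; coprime-Bézout)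
import Data.Nat.Divisibility as ℕD
import Data.Nat.DivMod as ℕDM
open import Data.Nat.GCD using (module Bézout)
open import Data.Nat.Primality
  using (Prime; euclidsLemma; prime⇒irreducible; prime⇒nonTrivial; prime⇒nonZero; composite⇒¬prime; composite[4])
import Data.Nat.Properties as ℕP
import Data.Nat.Tactic.RingSolver as ℕ-Solver
open import Data.Product using (Σ; ∃-syntax; _×_; _,_; proj₁; proj₂)
open import Data.Sum using (_⊎_; inj₁; inj₂; [_,_]′)
open import Function.Base using (_∘_)
open import Function.Bundles using (_⇔_; mk⇔; Equivalence)
open import Function.Construct.Composition using (_⇔-∘_)
open import Relation.Binary.PropositionalEquality
  using (_≡_; _≢_; refl; sym; trans; cong; cong₂; subst; subst₂; module ≡-Reasoning)
open import Relation.Nullary using (¬_; ¬?; yes; no)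

open import Defs

-- Congruences modulo a prime

∣-combination : ∀ {k a b c} → k ∣ a → k ∣ b → ∀ x y → c ≡ x * a + y * b → k ∣ c
∣-combination k∣a k∣b x y refl = ∣m∣n⇒∣m+n (∣n⇒∣m*n x k∣a) (∣n⇒∣m*n y k∣b)

∣-^-suc : ∀ k n → k ∣ k ^ suc n
∣-^-suc k n = divides (k ^ n) (ℤP.*-comm k (k ^ n))

^-mono-∣ : ∀ k {m n} → m ℕ.≤ n → k ^ m ∣ k ^ n
^-mono-∣ k {m} m≤n with ℕP.m≤n⇒∃[o]m+o≡n m≤n
... | o , refl = divides (k ^ o) (trans (ℤP.^-distribˡ-+-* k m o) (ℤP.*-comm (k ^ m) (k ^ o)))

^-*-comm : ∀ x m n → x ^ (m ℕ.* n) ≡ (x ^ n) ^ m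
^-*-comm x m n = trans (cong (x ^_) (ℕP.*-comm m n)) (sym (ℤP.^-*-assoc x n m))

square-cong : ∀ {k x y a} → k ∣ x * x - a → k ∣ x - y → k ∣ y * y - a
square-cong {x = x} {y} {a} x²≡a x≡y = ∣-combination x²≡a x≡y (+ 1) (- (x + y)) (difference x y a)
  where
  difference : ∀ x y a → y * y - a ≡ + 1 * (x * x - a) + (- (x + y)) * (x - y)
  difference = solve-∀

+-∸ : ∀ {m n} → n ℕ.≤ m → + (m ℕ.∸ n) ≡ + m - + n
+-∸ {m} {n} n≤m = sym (trans (ℤP.m-n≡m⊖n m n) (ℤP.⊖-≥ n≤m))

x+y-x≡y : ∀ x y → x + y - x ≡ y
x+y-x≡y = solve-∀

+[m+n]-m≡n : ∀ m n → + (m ℕ.+ n) - + m ≡ + n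
+[m+n]-m≡n m n = trans (cong (_- + m) (ℤP.pos-+ m n)) (x+y-x≡y (+ m) (+ n))

residue : ∀ p .{{_ : ℕ.NonZero p}} z → ∃[ r ] r ℕ.< p × + p ∣ z - + r
residue p z = z ℤDM.% + p , ℤDM.n%d<d z (+ p) , divides (z ℤDM./ + p) (remainder (ℤDM.a≡a%n+[a/n]*n z (+ p)))
  where
  remainder : ∀ {z r q} → z ≡ r + q → z - r ≡ q
  remainder {r = r} {q} refl = x+y-x≡y r q

residue-injective-≤ : ∀ {p x y} → y ℕ.≤ x → x ℕ.< p → + p ∣ + x - + y → x ≡ y
residue-injective-≤ {p} {x} {y} y≤x x<p p∣x-y with x ℕ.∸ y in x∸y≡d
... | zero = ℕP.≤-antisym (ℕP.m∸n≡0⇒m≤n x∸y≡d) y≤x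
... | suc d = ⊥-elim (ℕD.>⇒∤ d<p (subst (p ℕD.∣_) |x-y|≡d (∣⇒∣ᵤ p∣x-y)))
  where
  d<p : suc d ℕ.< p
  d<p = subst (ℕ._< p) x∸y≡d (ℕP.≤-<-trans (ℕP.m∸n≤m x y) x<p)
  |x-y|≡d : ℤ.∣ + x - + y ∣ ≡ suc d
  |x-y|≡d = cong ℤ.∣_∣ (trans (ℤP.m-n≡m⊖n x y) (trans (ℤP.⊖-≥ y≤x) (cong +_ x∸y≡d)))

residue-injective : ∀ {p x y} → x ℕ.< p → y ℕ.< p → + p ∣ + x - + y → x ≡ y
residue-injective {p} {x} {y} x<p y<p p∣x-y with ℕP.≤-total y x
... | inj₁ y≤x = residue-injective-≤ y≤x x<p p∣x-y
... | inj₂ x≤y = sym (residue-injective-≤ x≤y y<p (subst (+ p ∣_) (flip (+ x) (+ y)) (∣m⇒∣-m p∣x-y)))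
  where
  flip : ∀ x y → - (x - y) ≡ y - x
  flip = solve-∀

residue-negation : ∀ {p z r} → z ℕ.< p → 0 ℕ.< r → r ℕ.≤ p → + p ∣ + z + + r → z ≡ p ℕ.∸ r
residue-negation {p} {z} {r} z<p 0<r r≤p p∣z+r = residue-injective z<p (ℕP.∸-monoʳ-< 0<r r≤p) p∣z-[p-r]
  where
  p∣z-[p-r] : + p ∣ + z - + (p ℕ.∸ r)
  p∣z-[p-r] = ∣-combination p∣z+r (divides (+ 1) (sym (ℤP.*-identityˡ (+ p)))) (+ 1) (- (+ 1))
                (trans (cong (λ s → + z - s) (+-∸ r≤p)) (shift (+ z) (+ r) (+ p)))
    where
    shift : ∀ z r p → z - (p - r) ≡ + 1 * (z + r) + (- (+ 1)) * p
    shift = solve-∀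

module _ {p : ℕ} (p-prime : Prime p) where

  prime>1 : 1 ℕ.< p
  prime>1 = ℕ.nonTrivial⇒n>1 p {{prime⇒nonTrivial p-prime}}

  euclidsLemmaℤ : ∀ a b → + p ∣ a * b → + p ∣ a ⊎ + p ∣ b
  euclidsLemmaℤ a b p∣ab with euclidsLemma ℤ.∣ a ∣ ℤ.∣ b ∣ p-prime (subst (p ℕD.∣_) (ℤP.abs-* a b) (∣⇒∣ᵤ p∣ab))
  ... | inj₁ p∣a = inj₁ (∣ᵤ⇒∣ p∣a)
  ... | inj₂ p∣b = inj₂ (∣ᵤ⇒∣ p∣b)

  prime∤* : ∀ {a b} → ¬ + p ∣ a → ¬ + p ∣ b → ¬ + p ∣ a * b
  prime∤* {a} {b} p∤a p∤b p∣ab = [ p∤a , p∤b ]′ (euclidsLemmaℤ a b p∣ab)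

  prime∣²⇒∣ : ∀ {a} → + p ∣ a * a → + p ∣ a
  prime∣²⇒∣ {a} p∣a² = [ (λ p∣a → p∣a) , (λ p∣a → p∣a) ]′ (euclidsLemmaℤ a a p∣a²)

  prime∤residue : ∀ {k} → 0 ℕ.< k → k ℕ.< p → ¬ + p ∣ + k
  prime∤residue {suc k} _ k<p p∣k = ℕD.>⇒∤ k<p (∣⇒∣ᵤ p∣k)

  prime∤1 : ¬ + p ∣ + 1
  prime∤1 = prime∤residue (s≤s z≤n) prime>1

  private
    prime-coprime : ∀ {n} → ¬ p ℕD.∣ n → Coprime p n
    prime-coprime p∤n {d} (d∣p , d∣n) with prime⇒irreducible p-prime d∣p
    ... | inj₁ d≡1 = d≡1
    ... | inj₂ refl = ⊥-elim (p∤n d∣n)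

    toℤ : ∀ u v w z → 1 ℕ.+ u ℕ.* v ≡ w ℕ.* z → + 1 + + u * + v ≡ + w * + z
    toℤ u v w z eq = begin
      + 1 + + u * + v   ≡⟨ cong (λ z → + 1 + z) (ℤP.pos-* u v) ⟨
      + (1 ℕ.+ u ℕ.* v) ≡⟨ cong +_ eq ⟩
      + (w ℕ.* z)       ≡⟨ ℤP.pos-* w z ⟩
      + w * + z         ∎
      where open ≡-Reasoning

    inverse-modℕ : ∀ n → ¬ p ℕD.∣ n → ∃[ b ] + p ∣ + n * b - + 1
    inverse-modℕ n p∤n with coprime-Bézout (prime-coprime p∤n)
    ... | Bézout.+- x y eq = - + y , divides (- + x) (trans (negated (+ n) (+ y)) (trans (cong -_ (toℤ y n x p eq)) (ℤP.neg-distribˡ-* (+ x) (+ p))))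
      where
      negated : ∀ n y → n * (- y) - + 1 ≡ - (+ 1 + y * n)
      negated = solve-∀
    ... | Bézout.-+ x y eq = + y , divides (+ x) (begin
      + n * + y - + 1       ≡⟨ cong (_- + 1) (ℤP.*-comm (+ n) (+ y)) ⟩
      + y * + n - + 1       ≡⟨ cong (_- + 1) (toℤ x p y n eq) ⟨
      + 1 + + x * + p - + 1 ≡⟨ x+y-x≡y (+ 1) (+ x * + p) ⟩
      + x * + p             ∎)
      where open ≡-Reasoning

  inverse-mod : ∀ a → ¬ + p ∣ a → ∃[ b ] + p ∣ a * b - + 1
  inverse-mod a p∤a with inverse-modℕ ℤ.∣ a ∣ (λ p∣|a| → p∤a (∣ᵤ⇒∣ p∣|a|)) | ℤP.+∣i∣≡i⊎+∣i∣≡-i a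
  ... | b , p∣|a|b-1 | inj₁ |a|≡a = b , subst (λ z → + p ∣ z * b - + 1) |a|≡a p∣|a|b-1
  ... | b , p∣|a|b-1 | inj₂ |a|≡-a = - b , subst (+ p ∣_) (sign-flip a b |a|≡-a) p∣|a|b-1
    where
    sign-flip : ∀ a b {c} → c ≡ - a → c * b - + 1 ≡ a * (- b) - + 1
    sign-flip a b refl = move-sign a b
      where
      move-sign : ∀ a b → (- a) * b - + 1 ≡ a * (- b) - + 1
      move-sign = solve-∀

-- Hensel lifting of square roots

HasSqrt : ℕ → ℤ → Set
HasSqrt p c = Σ ℤ[ p ] λ y → ∀ n → (+ p) ^ n ∣ digit y n * digit y n - c

record RootLifting (p : ℕ) (c : ℤ) : Set₁ where
  field
    Approx : ℕ → ℤ → Set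
    approx₀ : Σ ℤ (Approx 0)
    lift : ∀ {n w} → Approx n w → Σ ℤ λ w′ → Approx (suc n) w′ × (+ p) ^ n ∣ w′ - w
    approx-root : ∀ {n w} → Approx n w → (+ p) ^ n ∣ w * w - c

  approximation : (n : ℕ) → Σ ℤ (Approx n)
  approximation zero = approx₀
  approximation (suc n) = proj₁ next , proj₁ (proj₂ next)
    where
    next : Σ ℤ λ w′ → Approx (suc n) w′ × (+ p) ^ n ∣ w′ - proj₁ (approximation n)
    next = lift (proj₂ (approximation n))

  sqrt : HasSqrt p c
  sqrt = record { digit = λ n → proj₁ (approximation n) ; coherent = approximation-coherent }
       , λ n → approx-root (proj₂ (approximation n))
    where
    approximation-coherent : ∀ n → (+ p) ^ n ℤD.∣ proj₁ (approximation (suc n)) - proj₁ (approximation n)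
    approximation-coherent n = ∣⇒∣ᵤ (proj₂ (proj₂ (lift (proj₂ (approximation n)))))

module _ {p} (p-prime : Prime p) {c t : ℤ} (t²≡c : + p ∣ t * t - c) (p∤2t : ¬ + p ∣ + 2 * t) where

  private
    e : ℤ
    e = proj₁ (inverse-mod p-prime (+ 2 * t) p∤2t)

    2te≡1 : + p ∣ + 2 * t * e - + 1
    2te≡1 = proj₂ (inverse-mod p-prime (+ 2 * t) p∤2t)

    Approx : ℕ → ℤ → Set
    Approx n w = (+ p) ^ suc n ∣ w * w - c × + p ∣ w - t

    newton-identity : ∀ w c r e Q t → w * w - c ≡ r * Q →
      (w - r * e * Q) * (w - r * e * Q) - c
        ≡ (r * (+ 1 - + 2 * t * e) - + 2 * (w - t) * r * e + r * r * e * e * Q) * Q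
    newton-identity w c r e Q t w²-c≡rQ = begin
      (w - r * e * Q) * (w - r * e * Q) - c
        ≡⟨ expand w c r e Q ⟩
      (w * w - c) - + 2 * w * r * e * Q + r * r * e * e * Q * Q
        ≡⟨ cong (λ z → z - + 2 * w * r * e * Q + r * r * e * e * Q * Q) w²-c≡rQ ⟩
      r * Q - + 2 * w * r * e * Q + r * r * e * e * Q * Q
        ≡⟨ regroup w r e Q t ⟩
      (r * (+ 1 - + 2 * t * e) - + 2 * (w - t) * r * e + r * r * e * e * Q) * Q ∎
      where
      open ≡-Reasoning
      expand : ∀ w c r e Q → (w - r * e * Q) * (w - r * e * Q) - c ≡ (w * w - c) - + 2 * w * r * e * Q + r * r * e * e * Q * Q
      expand = solve-∀
      regroup : ∀ w r e Q t → r * Q - + 2 * w * r * e * Q + r * r * e * e * Q * Q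
                              ≡ (r * (+ 1 - + 2 * t * e) - + 2 * (w - t) * r * e + r * r * e * e * Q) * Q
      regroup = solve-∀

    -- Newton's step w ↦ w − (w² − c)·e with e ≡ (2t)⁻¹, a valid inverse of 2w because w ≡ t (mod p).
    newton : ∀ {n w} → Approx n w → Σ ℤ λ w′ → Approx (suc n) w′ × (+ p) ^ n ∣ w′ - w
    newton {n} {w} (divides r w²-c≡rQ , w≡t) = w′ , (w′²≡c , w′≡t) , w′≡w
      where
      Q : ℤ
      Q = (+ p) ^ suc n
      w′ : ℤ
      w′ = w - r * e * Q
      p∣Q : + p ∣ Q
      p∣Q = ∣-^-suc (+ p) n
      p∣correction : + p ∣ r * (+ 1 - + 2 * t * e) - + 2 * (w - t) * r * e + r * r * e * e * Q
      p∣correction = ∣m∣n⇒∣m+n (∣-combination 2te≡1 w≡t (- r) (- (+ 2 * r * e)) (linear r t e w)) (∣n⇒∣m*n (r * r * e * e) p∣Q)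
        where
        linear : ∀ r t e w → r * (+ 1 - + 2 * t * e) - + 2 * (w - t) * r * e ≡ (- r) * (+ 2 * t * e - + 1) + (- (+ 2 * r * e)) * (w - t)
        linear = solve-∀
      w′²≡c : (+ p) ^ suc (suc n) ∣ w′ * w′ - c
      w′²≡c = subst (_ ∣_) (sym (newton-identity w c r e Q t w²-c≡rQ)) (*-monoˡ-∣ Q p∣correction)
      w′≡t : + p ∣ w′ - t
      w′≡t = ∣-combination w≡t p∣Q (+ 1) (- (r * e)) (shift w r e Q t)
        where
        shift : ∀ w r e Q t → w - r * e * Q - t ≡ + 1 * (w - t) + (- (r * e)) * Q
        shift = solve-∀
      w′≡w : (+ p) ^ n ∣ w′ - w
      w′≡w = ∣-trans (^-mono-∣ (+ p) (ℕP.n≤1+n n)) (divides (- (r * e)) (step w r e Q))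
        where
        step : ∀ w r e Q → w - r * e * Q - w ≡ (- (r * e)) * Q
        step = solve-∀

  hensel-odd : HasSqrt p c
  hensel-odd = RootLifting.sqrt record
    { Approx = Approx
    ; approx₀ = t , subst (_∣ t * t - c) (sym (ℤP.*-identityʳ (+ p))) t²≡c , divides (+ 0) (ℤP.+-inverseʳ t)
    ; lift = λ {n} → newton {n}
    ; approx-root = λ {n} (root , _) → ∣-trans (^-mono-∣ (+ p) (ℕP.n≤1+n n)) root
    }

module _ {c : ℤ} (c≡1 : + 8 ∣ c - + 1) where

  private
    Approx : ℕ → ℤ → Set
    Approx n w = (+ 2) ^ (3 ℕ.+ n) ∣ w * w - c × + 2 ∣ w - + 1

    correction-identity : ∀ w c r a b T → w * w - c ≡ r * (+ 2 * (+ 2 * (+ 2 * T))) →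
      r - + 1 ≡ a * + 2 → w - + 1 ≡ b * + 2 →
      (w + + 2 * (+ 2 * T)) * (w + + 2 * (+ 2 * T)) - c ≡ (a + b + + 1 + T) * (+ 2 * (+ 2 * (+ 2 * (+ 2 * T))))
    correction-identity w c r a b T w²-c≡rQ r-1≡2a w-1≡2b = begin
      (w + + 2 * (+ 2 * T)) * (w + + 2 * (+ 2 * T)) - c  ≡⟨ expand w c T ⟩
      (w * w - c) + + 8 * T * w + + 16 * T * T           ≡⟨ cong (λ z → z + + 8 * T * w + + 16 * T * T) w²-c≡rQ ⟩
      r * (+ 2 * (+ 2 * (+ 2 * T))) + + 8 * T * w + + 16 * T * T ≡⟨ regroup r w T ⟩
      ((r - + 1) + (w - + 1) + + 2 + + 2 * T) * (+ 8 * T) ≡⟨ cong₂ (λ x y → (x + y + + 2 + + 2 * T) * (+ 8 * T)) r-1≡2a w-1≡2b ⟩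
      (a * + 2 + b * + 2 + + 2 + + 2 * T) * (+ 8 * T)     ≡⟨ halve a b T ⟩
      (a + b + + 1 + T) * (+ 2 * (+ 2 * (+ 2 * (+ 2 * T)))) ∎
      where
      open ≡-Reasoning
      expand : ∀ w c T → (w + + 2 * (+ 2 * T)) * (w + + 2 * (+ 2 * T)) - c ≡ (w * w - c) + + 8 * T * w + + 16 * T * T
      expand = solve-∀
      regroup : ∀ r w T → r * (+ 2 * (+ 2 * (+ 2 * T))) + + 8 * T * w + + 16 * T * T ≡ ((r - + 1) + (w - + 1) + + 2 + + 2 * T) * (+ 8 * T)
      regroup = solve-∀
      halve : ∀ a b T → (a * + 2 + b * + 2 + + 2 + + 2 * T) * (+ 8 * T) ≡ (a + b + + 1 + T) * (+ 2 * (+ 2 * (+ 2 * (+ 2 * T))))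
      halve = solve-∀

    -- For odd w, (w + 2^(n+2))² ≡ w² + 2^(n+3) (mod 2^(n+4)): adding 2^(n+2) clears the next bit of w² − c.
    correct : ∀ {n w} → Approx n w → Σ ℤ λ w′ → Approx (suc n) w′ × (+ 2) ^ n ∣ w′ - w
    correct {n} {w} (divides r w²-c≡rQ , w≡1@(divides b w-1≡2b)) with residue 2 r
    ... | 0 , _ , divides k r≡2k = w , (divides k w²-c≡2kQ , w≡1) , divides (+ 0) (ℤP.+-inverseʳ w)
      where
      Q : ℤ
      Q = (+ 2) ^ (3 ℕ.+ n)
      w²-c≡2kQ : w * w - c ≡ k * (+ 2 * Q)
      w²-c≡2kQ = trans w²-c≡rQ (trans (cong (_* Q) (trans (sym (ℤP.+-identityʳ r)) r≡2k)) (ℤP.*-assoc k (+ 2) Q))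
    ... | 1 , _ , divides a r-1≡2a = w + R , (w′²≡c , w′≡1) , divides (+ 4) (shift w T)
      where
      T : ℤ
      T = (+ 2) ^ n
      R : ℤ
      R = + 2 * (+ 2 * T)
      w′²≡c : (+ 2) ^ (4 ℕ.+ n) ∣ (w + R) * (w + R) - c
      w′²≡c = divides (a + b + + 1 + T) (correction-identity w c r a b T w²-c≡rQ r-1≡2a w-1≡2b)
      w′≡1 : + 2 ∣ w + R - + 1
      w′≡1 = ∣-combination w≡1 (divides (+ 2 * T) (ℤP.*-comm (+ 2) (+ 2 * T))) (+ 1) (+ 1) (split w R)
        where
        split : ∀ w R → w + R - + 1 ≡ + 1 * (w - + 1) + + 1 * R
        split = solve-∀
      shift : ∀ w T → w + + 2 * (+ 2 * T) - w ≡ + 4 * T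
      shift = solve-∀
    ... | suc (suc _) , s≤s (s≤s ()) , _

  hensel-2 : HasSqrt 2 c
  hensel-2 = RootLifting.sqrt record
    { Approx = Approx
    ; approx₀ = + 1 , subst (+ 8 ∣_) (flip c) (∣m⇒∣-m c≡1) , divides (+ 0) refl
    ; lift = λ {n} → correct {n}
    ; approx-root = λ {n} (root , _) → ∣-trans (^-mono-∣ (+ 2) (ℕP.m≤n+m n 3)) root
    }
    where
    flip : ∀ c → - (c - + 1) ≡ + 1 * + 1 - c
    flip = solve-∀

constant : ∀ {p} → ℤ → ℤ[ p ]
constant {p} z = record { digit = λ _ → z ; coherent = λ n → ∣⇒∣ᵤ {(+ p) ^ n} (divides (+ 0) (ℤP.+-inverseʳ z)) }

sqrt-*-square : ∀ {p c} a → HasSqrt p c → HasSqrt p (a * a * c)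
sqrt-*-square {p} {c} a (y , y²≡c) = a·y , λ n → subst ((+ p) ^ n ∣_) (scale a (digit y n) c) (∣n⇒∣m*n (a * a) (y²≡c n))
  where
  a·y : ℤ[ p ]
  a·y = record
    { digit = λ n → a * digit y n
    ; coherent = λ n → ∣⇒∣ᵤ (subst ((+ p) ^ n ∣_) (distrib a (digit y (suc n)) (digit y n)) (∣n⇒∣m*n a (∣ᵤ⇒∣ (coherent y n))))
    }
    where
    distrib : ∀ a u v → a * (u - v) ≡ a * u - a * v
    distrib = solve-∀
  scale : ∀ a y c → a * a * (y * y - c) ≡ a * y * (a * y) - a * a * c
  scale = solve-∀

module _ (s : ℤ) (v : ℕ) where

  point-at-0 : HasSqrt v -[1+ 1 ] → HasQvPoint s v
  point-at-0 (y , y²≡-2) = constant (+ 0) /p^ 0 , y /p^ 0 , λ n → ∣⇒∣ᵤ (subst (_ ∣_) (sym (equation (digit y n))) (y²≡-2 n))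
    where
    equation : ∀ B → CurveEqn s v (+ 0) B 0 0 ≡ B * B + + 2
    equation B = at-0 s B
      where
      at-0 : ∀ s B → B * (B * + 1) * + 1 - ((- (+ 2)) * + 0 + s * + 0 * + 1 - (+ 2) * + 1) * + 1 ≡ B * B + + 2
      at-0 = solve-∀

  point-at-1 : HasSqrt v (s - + 4) → HasQvPoint s v
  point-at-1 (y , y²≡s-4) = constant (+ 1) /p^ 0 , y /p^ 0 , λ n → ∣⇒∣ᵤ (subst (_ ∣_) (sym (equation (digit y n))) (y²≡s-4 n))
    where
    equation : ∀ B → CurveEqn s v (+ 1) B 0 0 ≡ B * B - (s - + 4)
    equation B = at-1 s B
      where
      at-1 : ∀ s B → B * (B * + 1) * + 1 - ((- (+ 2)) * + 1 + s * + 1 * + 1 - (+ 2) * + 1) * + 1 ≡ B * B - (s - + 4)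
      at-1 = solve-∀

-- The obstruction at an odd prime

quartic : ℤ → ℤ → ℤ → ℤ
quartic s A J = (- (+ 2)) * (A * A * A * A) + s * (A * A) * (J * J) - + 2 * (J * J * J * J)

CurveEqn-homogeneous : ∀ s v g j A B l → let J = (+ v) ^ j in
  CurveEqn s v ((+ v) ^ g * A) B (g ℕ.+ j) l
    ≡ (+ v) ^ (4 ℕ.* g) * (B * (J * J) * (B * (J * J)) - quartic s A J * (+ v) ^ (2 ℕ.* l))
CurveEqn-homogeneous s v g j A B l = begin
  CurveEqn s v (G * A) B (g ℕ.+ j) l
    ≡⟨ cong₂ (λ x⁴ x² → B ^ 2 * x⁴ - ((- (+ 2)) * (G * A) ^ 4 + s * (G * A) ^ 2 * x² - (+ 2) * x⁴) * L) (power 4) (power 2) ⟩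
  B ^ 2 * (G * J) ^ 4 - ((- (+ 2)) * (G * A) ^ 4 + s * (G * A) ^ 2 * (G * J) ^ 2 - (+ 2) * (G * J) ^ 4) * L
    ≡⟨ factor B G J A s L ⟩
  G ^ 4 * (B * (J * J) * (B * (J * J)) - quartic s A J * L)
    ≡⟨ cong (_* (B * (J * J) * (B * (J * J)) - quartic s A J * L)) (^-*-comm (+ v) 4 g) ⟨
  (+ v) ^ (4 ℕ.* g) * (B * (J * J) * (B * (J * J)) - quartic s A J * L) ∎
  where
  open ≡-Reasoning
  G : ℤ
  G = (+ v) ^ g
  J : ℤ
  J = (+ v) ^ j
  L : ℤ
  L = (+ v) ^ (2 ℕ.* l)
  power : ∀ m → (+ v) ^ (m ℕ.* (g ℕ.+ j)) ≡ (G * J) ^ m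
  power m = trans (^-*-comm (+ v) m (g ℕ.+ j)) (cong (_^ m) (ℤP.^-distribˡ-+-* (+ v) g j))
  -- The ring solver does not know _^_, so the powers are unfolded.
  factor : ∀ B G J A s L →
    B * (B * + 1) * ((G * J) * ((G * J) * ((G * J) * ((G * J) * + 1))))
    - ((- (+ 2)) * ((G * A) * ((G * A) * ((G * A) * ((G * A) * + 1))))
       + s * ((G * A) * ((G * A) * + 1)) * ((G * J) * ((G * J) * + 1))
       - (+ 2) * ((G * J) * ((G * J) * ((G * J) * ((G * J) * + 1))))) * L
    ≡ G * (G * (G * (G * + 1))) * (B * (J * J) * (B * (J * J)) - ((- (+ 2)) * (A * A * A * A) + s * (A * A) * (J * J) - + 2 * (J * J * J * J)) * L)
  factor = solve-∀

quartic-complete-square : ∀ ε c A J → ε * ε ≡ + 1 →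
  quartic (+ 4 * ε + + 4 * c) A J ≡ (- (+ 2)) * ((A * A - ε * (J * J)) * (A * A - ε * (J * J))) + c * (+ 4 * (A * A) * (J * J))
quartic-complete-square ε c A J ε²≡1 = begin
  quartic (+ 4 * ε + + 4 * c) A J
    ≡⟨ expand A J ε c ⟩
  (- (+ 2)) * (D * D) + c * (+ 4 * (A * A) * (J * J)) + + 2 * (J * J * J * J) * (ε * ε - + 1)
    ≡⟨ cong (λ z → (- (+ 2)) * (D * D) + c * (+ 4 * (A * A) * (J * J)) + + 2 * (J * J * J * J) * (z - + 1)) ε²≡1 ⟩
  (- (+ 2)) * (D * D) + c * (+ 4 * (A * A) * (J * J)) + + 2 * (J * J * J * J) * (+ 1 - + 1)
    ≡⟨ vanish ((- (+ 2)) * (D * D) + c * (+ 4 * (A * A) * (J * J))) (+ 2 * (J * J * J * J)) ⟩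
  (- (+ 2)) * (D * D) + c * (+ 4 * (A * A) * (J * J)) ∎
  where
  open ≡-Reasoning
  D : ℤ
  D = A * A - ε * (J * J)
  expand : ∀ A J ε c → (- (+ 2)) * (A * A * A * A) + (+ 4 * ε + + 4 * c) * (A * A) * (J * J) - + 2 * (J * J * J * J)
    ≡ (- (+ 2)) * ((A * A - ε * (J * J)) * (A * A - ε * (J * J))) + c * (+ 4 * (A * A) * (J * J)) + + 2 * (J * J * J * J) * (ε * ε - + 1)
  expand = solve-∀
  vanish : ∀ x y → x + y * (+ 1 - + 1) ≡ x
  vanish = solve-∀

-2IsSquareMod : ℕ → Set
-2IsSquareMod p = ∃[ x ] + p ∣ x * x + + 2

module _ {p : ℕ} (p-prime : Prime p) where

  private
    P : ℤ
    P = + p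

  p^≢0 : ∀ n → P ^ n ≢ + 0
  p^≢0 n p^n≡0 = ℕP.<⇒≢ (ℕP.<-trans (s≤s z≤n) (prime>1 p-prime)) (sym (ℤP.+-injective (ℤP.i^n≡0⇒i≡0 P n p^n≡0)))

  p^-cancel : ∀ a {X Y} → P ^ a * X ∣ P ^ a * Y → X ∣ Y
  p^-cancel a = *-cancelˡ-∣ (P ^ a) {{ℤ.≢-nonZero (p^≢0 a)}}

  p^suc-cancel : ∀ a {Y} → P ^ suc a ∣ P ^ a * Y → P ∣ Y
  p^suc-cancel a {Y} = p^-cancel a ∘ subst (_∣ P ^ a * Y) (ℤP.*-comm P (P ^ a))

  strip-powers : ∀ k A → ∃[ g ] ∃[ j ] ∃[ A′ ] g ℕ.+ j ≡ k × A ≡ P ^ g * A′ × (j ≡ 0 ⊎ ¬ P ∣ A′)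
  strip-powers zero A = 0 , 0 , A , refl , sym (ℤP.*-identityˡ A) , inj₁ refl
  strip-powers (suc k) A with P ∣? A
  ... | no p∤A = 0 , suc k , A , refl , sym (ℤP.*-identityˡ A) , inj₂ p∤A
  ... | yes (divides A₁ A≡A₁p) with strip-powers k A₁
  ...   | g , j , A′ , g+j≡k , A₁≡p^gA′ , reduced =
    suc g , j , A′ , cong suc g+j≡k , trans A≡A₁p (trans (cong (_* P) A₁≡p^gA′) (shift (P ^ g) A′ P)) , reduced
    where
    shift : ∀ G A P → G * A * P ≡ P * G * A
    shift = solve-∀

  valuation-≤ : ∀ {M e m V U} → ¬ P ∣ U → m ℕ.< M → P ^ M ∣ P ^ e * V - P ^ m * U → e ℕ.≤ m
  valuation-≤ {M} {e} {m} {V} {U} p∤U m<M p^M∣diff with e ℕ.≤? m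
  ... | yes e≤m = e≤m
  ... | no e≰m = ⊥-elim (p∤U (p^suc-cancel m p^m+1∣p^mU))
    where
    p^m+1∣p^mU : P ^ suc m ∣ P ^ m * U
    p^m+1∣p^mU = ∣-combination (∣m⇒∣m*n V (^-mono-∣ P (ℕP.≰⇒> e≰m))) (∣-trans (^-mono-∣ P m<M) p^M∣diff) (+ 1) (- (+ 1))
                               (difference (P ^ e * V) (P ^ m * U))
      where
      difference : ∀ x y → y ≡ + 1 * x + (- (+ 1)) * (x - y)
      difference = solve-∀

  square≡p^m*unit : ∀ {M m Z U} → ¬ P ∣ U → m ℕ.< M → P ^ M ∣ Z * Z - P ^ m * U →
                    ∃[ h ] 2 ℕ.* h ≡ m × ∃[ W ] P ∣ W * W - U
  square≡p^m*unit {M} {m} {Z} {U} p∤U m<M p^M∣Z²-p^mU with strip-powers M Z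
  ... | h , i , W , h+i≡M , Z≡p^hW , reduced = h , 2h≡m , W , W²≡U
    where
    Z²≡p^2hW² : Z * Z ≡ P ^ (2 ℕ.* h) * (W * W)
    Z²≡p^2hW² = begin
      Z * Z                       ≡⟨ cong (λ z → z * z) Z≡p^hW ⟩
      P ^ h * W * (P ^ h * W)     ≡⟨ square (P ^ h) W ⟩
      P ^ h * (P ^ h * + 1) * (W * W) ≡⟨ cong (_* (W * W)) (^-*-comm P 2 h) ⟨
      P ^ (2 ℕ.* h) * (W * W)     ∎
      where
      open ≡-Reasoning
      square : ∀ G W → G * W * (G * W) ≡ G * (G * + 1) * (W * W)
      square = solve-∀
    p^M∣diff : P ^ M ∣ P ^ (2 ℕ.* h) * (W * W) - P ^ m * U
    p^M∣diff = subst (λ z → P ^ M ∣ z - P ^ m * U) Z²≡p^2hW² p^M∣Z²-p^mU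
    2h≤m : 2 ℕ.* h ℕ.≤ m
    2h≤m = valuation-≤ p∤U m<M p^M∣diff
    i≢0 : i ≢ 0
    i≢0 i≡0 = ℕP.<-irrefl refl (begin-strict
      M           ≡⟨ h+i≡M ⟨
      h ℕ.+ i     ≡⟨ cong (h ℕ.+_) i≡0 ⟩
      h ℕ.+ 0     ≡⟨ ℕP.+-identityʳ h ⟩
      h           ≤⟨ ℕP.m≤m+n h (h ℕ.+ 0) ⟩
      2 ℕ.* h     ≤⟨ 2h≤m ⟩
      m           <⟨ m<M ⟩
      M           ∎)
      where open ℕP.≤-Reasoning
    p∤W : ¬ P ∣ W
    p∤W = [ ⊥-elim ∘ i≢0 , (λ p∤W → p∤W) ]′ reduced
    m≤2h : m ℕ.≤ 2 ℕ.* h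
    m≤2h = valuation-≤ (prime∤* p-prime p∤W p∤W) (ℕP.≤-<-trans 2h≤m m<M)
                       (subst (P ^ M ∣_) (flip (P ^ (2 ℕ.* h) * (W * W)) (P ^ m * U)) (∣m⇒∣-m p^M∣diff))
      where
      flip : ∀ x y → - (x - y) ≡ y - x
      flip = solve-∀
    2h≡m : 2 ℕ.* h ≡ m
    2h≡m = ℕP.≤-antisym 2h≤m m≤2h
    W²≡U : P ∣ W * W - U
    W²≡U = p^suc-cancel m (∣-trans (^-mono-∣ P m<M)
             (subst (P ^ M ∣_) (factor (W * W) U) (subst (λ k → P ^ M ∣ P ^ k * (W * W) - P ^ m * U) 2h≡m p^M∣diff)))
      where
      factor : ∀ x y → P ^ m * x - P ^ m * y ≡ P ^ m * (x - y)
      factor x y = distrib (P ^ m) x y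
        where
        distrib : ∀ c x y → c * x - c * y ≡ c * (x - y)
        distrib = solve-∀

  -2-square-of-ratio : ∀ {W D} → ¬ P ∣ D → P ∣ W * W + + 2 * (D * D) → -2IsSquareMod p
  -2-square-of-ratio {W} {D} p∤D p∣W²+2D² with inverse-mod p-prime D p∤D
  ... | D⁻¹ , DD⁻¹≡1 = W * D⁻¹ , ∣-combination p∣W²+2D² DD⁻¹≡1 (D⁻¹ * D⁻¹) (- (+ 2) * (D * D⁻¹ + + 1)) (ratio W D D⁻¹)
    where
    ratio : ∀ W D E → W * E * (W * E) + + 2 ≡ E * E * (W * W + + 2 * (D * D)) + - (+ 2) * (D * E + + 1) * (D * E - + 1)
    ratio = solve-∀

module _ {p : ℕ} (p-prime : Prime p) (p∤2 : ¬ + p ∣ + 2) {ε : ℤ} (ε²≡1 : ε * ε ≡ + 1) where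

  private
    P : ℤ
    P = + p

    s : ℤ
    s = + 4 * ε + + 4 * P

  -- Modulo p the quartic is −2D² where D = A² − εJ²: if p ∤ D, a square
  -- root W of the quartic gives −2 ≡ (W / D)²; if p ∣ D, the quartic is p times a unit, and then
  -- p^(2l) times it is not a square modulo p^(2l+2).
  module _ {j : ℕ} {A : ℤ} where

    private
      J : ℤ
      J = P ^ j
      D : ℤ
      D = A * A - ε * (J * J)
      Q : ℤ
      Q = + 4 * (A * A) * (J * J)
      F : ℤ
      F = quartic s A J

      F≡-2D²+pQ : F ≡ (- (+ 2)) * (D * D) + P * Q
      F≡-2D²+pQ = quartic-complete-square ε P A J ε²≡1

      p∣F+2D² : P ∣ F + + 2 * (D * D)
      p∣F+2D² = divides Q (trans (cong (_+ + 2 * (D * D)) F≡-2D²+pQ) (cancel (D * D) P Q))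
        where
        cancel : ∀ x P Q → (- (+ 2)) * x + P * Q + + 2 * x ≡ Q * P
        cancel = solve-∀

      p∤F : ¬ P ∣ D → ¬ P ∣ F
      p∤F p∤D p∣F = [ p∤2 ∘ ∣m⇒∣-m , p∤D ∘ prime∣²⇒∣ p-prime ]′ (euclidsLemmaℤ p-prime (- (+ 2)) (D * D) p∣-2D²)
        where
        p∣-2D² : P ∣ (- (+ 2)) * (D * D)
        p∣-2D² = ∣-combination p∣F p∣F+2D² (+ 1) (- (+ 1)) (rearrange F (D * D))
          where
          rearrange : ∀ F x → (- (+ 2)) * x ≡ + 1 * F + (- (+ 1)) * (F + + 2 * x)
          rearrange = solve-∀

      unit-case : ¬ P ∣ D → ∃[ W ] P ∣ W * W - F → -2IsSquareMod p
      unit-case p∤D (W , p∣W²-F) =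
        -2-square-of-ratio p-prime {W} p∤D (subst (P ∣_) (cancel (W * W) F (D * D)) (∣m∣n⇒∣m+n p∣W²-F p∣F+2D²))
        where
        cancel : ∀ y F x → y - F + (F + + 2 * x) ≡ y + + 2 * x
        cancel = solve-∀

      p∤J : (j ≡ 0 ⊎ ¬ P ∣ A) → P ∣ D → ¬ P ∣ J
      p∤J (inj₁ j≡0) _ p∣J = prime∤1 p-prime (subst (λ k → P ∣ P ^ k) j≡0 p∣J)
      p∤J (inj₂ p∤A) p∣D p∣J =
        p∤A (prime∣²⇒∣ p-prime (∣-combination p∣D (∣n⇒∣m*n ε (∣m⇒∣m*n J p∣J)) (+ 1) (+ 1) (split A ε J)))
        where
        split : ∀ A ε J → A * A ≡ + 1 * (A * A - ε * (J * J)) + + 1 * (ε * (J * J))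
        split = solve-∀

      p∤A : (j ≡ 0 ⊎ ¬ P ∣ A) → P ∣ D → ¬ P ∣ A
      p∤A reduced p∣D p∣A = [ p∤ε , p∤J reduced p∣D ∘ prime∣²⇒∣ p-prime ]′ (euclidsLemmaℤ p-prime ε (J * J) p∣εJ²)
        where
        p∤ε : ¬ P ∣ ε
        p∤ε p∣ε = prime∤1 p-prime (subst (P ∣_) ε²≡1 (∣m⇒∣m*n ε p∣ε))
        p∣εJ² : P ∣ ε * (J * J)
        p∣εJ² = ∣-combination (∣m⇒∣m*n A p∣A) p∣D (+ 1) (- (+ 1)) (split A ε J)
          where
          split : ∀ A ε J → ε * (J * J) ≡ + 1 * (A * A) + (- (+ 1)) * (A * A - ε * (J * J))
          split = solve-∀

      nonunit-case : ∀ B l → (j ≡ 0 ⊎ ¬ P ∣ A) → P ∣ D →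
        ¬ P ^ (2 ℕ.* l ℕ.+ 2) ∣ B * (J * J) * (B * (J * J)) - P ^ (2 ℕ.* l) * F
      nonunit-case B l reduced p∣D@(divides t D≡tP) p^2l+2∣Y²-p^2lF =
        ℕP.even≢odd (proj₁ root) l (proj₁ (proj₂ root))
        where
        U : ℤ
        U = (- (+ 2)) * (t * t) * P + Q
        F≡pU : F ≡ P * U
        F≡pU = trans F≡-2D²+pQ (trans (cong (λ d → (- (+ 2)) * (d * d) + P * Q) D≡tP) (factor t P Q))
          where
          factor : ∀ t P Q → (- (+ 2)) * (t * P * (t * P)) + P * Q ≡ P * ((- (+ 2)) * (t * t) * P + Q)
          factor = solve-∀
        p∤Q : ¬ P ∣ Q
        p∤Q = prime∤* p-prime (prime∤* p-prime (prime∤* p-prime p∤2 p∤2) (prime∤* p-prime (p∤A reduced p∣D) (p∤A reduced p∣D)))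
                              (prime∤* p-prime (p∤J reduced p∣D) (p∤J reduced p∣D))
        p∤U : ¬ P ∣ U
        p∤U p∣U = p∤Q (∣-combination p∣U (divides ((- (+ 2)) * (t * t)) refl) (+ 1) (- (+ 1)) (split t P Q))
          where
          split : ∀ t P Q → Q ≡ + 1 * ((- (+ 2)) * (t * t) * P + Q) + (- (+ 1)) * ((- (+ 2)) * (t * t) * P)
          split = solve-∀
        2l+1<2l+2 : suc (2 ℕ.* l) ℕ.< 2 ℕ.* l ℕ.+ 2
        2l+1<2l+2 = ℕP.≤-reflexive (ℕP.+-comm 2 (2 ℕ.* l))
        p^2l+2∣Y²-p^2l+1U : P ^ (2 ℕ.* l ℕ.+ 2) ∣ B * (J * J) * (B * (J * J)) - P ^ suc (2 ℕ.* l) * U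
        p^2l+2∣Y²-p^2l+1U = subst (λ f → P ^ (2 ℕ.* l ℕ.+ 2) ∣ B * (J * J) * (B * (J * J)) - f)
                              (trans (cong (P ^ (2 ℕ.* l) *_) F≡pU) (swap (P ^ (2 ℕ.* l)) P U)) p^2l+2∣Y²-p^2lF
          where
          swap : ∀ L P U → L * (P * U) ≡ P * L * U
          swap = solve-∀
        root : ∃[ h ] 2 ℕ.* h ≡ suc (2 ℕ.* l) × ∃[ W ] P ∣ W * W - U
        root = square≡p^m*unit p-prime {Z = B * (J * J)} p∤U 2l+1<2l+2 p^2l+2∣Y²-p^2l+1U

    descent-coprime : ∀ B l → (j ≡ 0 ⊎ ¬ P ∣ A) →
      P ^ (2 ℕ.* l ℕ.+ 2) ∣ B * (P ^ j * P ^ j) * (B * (P ^ j * P ^ j)) - P ^ (2 ℕ.* l) * quartic s A (P ^ j) →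
      -2IsSquareMod p
    descent-coprime B l reduced p^2l+2∣Y²-p^2lF with P ∣? D
    ... | no p∤D =
      unit-case p∤D (proj₂ (proj₂ (square≡p^m*unit p-prime {Z = B * (J * J)} (p∤F p∤D) (ℕP.m<m+n (2 ℕ.* l) (s≤s z≤n)) p^2l+2∣Y²-p^2lF)))
    ... | yes p∣D = ⊥-elim (nonunit-case B l reduced p∣D p^2l+2∣Y²-p^2lF)

  descent-integral : ∀ A B k l → P ^ (4 ℕ.* k ℕ.+ 2 ℕ.* l ℕ.+ 2) ∣ CurveEqn s p A B k l → -2IsSquareMod p
  descent-integral A B k l p^N∣eqn with strip-powers p-prime k A
  ... | g , j , A′ , refl , refl , reduced = descent-coprime B l reduced (∣-trans (^-mono-∣ P (ℕP.m≤n+m _ (4 ℕ.* j))) cancelled)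
    where
    exponent : 4 ℕ.* (g ℕ.+ j) ℕ.+ 2 ℕ.* l ℕ.+ 2 ≡ 4 ℕ.* g ℕ.+ (4 ℕ.* j ℕ.+ (2 ℕ.* l ℕ.+ 2))
    exponent = solve g j l
      where
      solve : ∀ g j l → 4 ℕ.* (g ℕ.+ j) ℕ.+ 2 ℕ.* l ℕ.+ 2 ≡ 4 ℕ.* g ℕ.+ (4 ℕ.* j ℕ.+ (2 ℕ.* l ℕ.+ 2))
      solve = ℕ-Solver.solve-∀
    cancelled : P ^ (4 ℕ.* j ℕ.+ (2 ℕ.* l ℕ.+ 2)) ∣ B * (P ^ j * P ^ j) * (B * (P ^ j * P ^ j)) - P ^ (2 ℕ.* l) * quartic s A′ (P ^ j)
    cancelled = p^-cancel p-prime (4 ℕ.* g) (subst₂ _∣_ (trans (cong (P ^_) exponent) (ℤP.^-distribˡ-+-* P (4 ℕ.* g) _)) homogeneous p^N∣eqn)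
      where
      Y : ℤ
      Y = B * (P ^ j * P ^ j)
      homogeneous : CurveEqn s p (P ^ g * A′) B (g ℕ.+ j) l ≡ P ^ (4 ℕ.* g) * (Y * Y - P ^ (2 ℕ.* l) * quartic s A′ (P ^ j))
      homogeneous = trans (CurveEqn-homogeneous s p g j A′ B l)
                          (cong (λ z → P ^ (4 ℕ.* g) * (Y * Y - z)) (ℤP.*-comm (quartic s A′ (P ^ j)) (P ^ (2 ℕ.* l))))

  -- The congruence modulo p^(4k+2l+2) alone already carries the obstruction.
  descent : HasQvPoint s p → -2IsSquareMod p
  descent ((a /p^ k) , (b /p^ l) , on-curve) = descent-integral (digit a N) (digit b N) k l (∣ᵤ⇒∣ (on-curve N))
    where
    N : ℕ
    N = 4 ℕ.* k ℕ.+ 2 ℕ.* l ℕ.+ 2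

-- Euler's criterion

∏ : List ℕ → ℤ
∏ [] = + 1
∏ (x ∷ xs) = + x * ∏ xs

remove : ℕ → List ℕ → List ℕ
remove r = filter (λ z → ¬? (z ℕ.≟ r))

module _ {r : ℕ} where

  ∈-remove⁺ : ∀ {z xs} → z ∈ xs → z ≢ r → z ∈ remove r xs
  ∈-remove⁺ = ∈-filter⁺ (λ z → ¬? (z ℕ.≟ r))

  ∈-remove⁻ : ∀ {z xs} → z ∈ remove r xs → z ∈ xs × z ≢ r
  ∈-remove⁻ = ∈-filter⁻ (λ z → ¬? (z ℕ.≟ r))

  remove-unique : ∀ {xs} → Unique xs → Unique (remove r xs)
  remove-unique = UniqueP.filter⁺ (λ z → ¬? (z ℕ.≟ r))

  private
    remove-head : ∀ {xs} → All (r ≢_) xs → remove r (r ∷ xs) ≡ xs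
    remove-head r∉xs = trans (ListP.filter-reject (λ z → ¬? (z ℕ.≟ r)) (λ r≢r → r≢r refl))
                              (ListP.filter-all (λ z → ¬? (z ℕ.≟ r)) (All.map (λ r≢z z≡r → r≢z (sym z≡r)) r∉xs))

    remove-tail : ∀ {x xs} → x ≢ r → remove r (x ∷ xs) ≡ x ∷ remove r xs
    remove-tail = ListP.filter-accept (λ z → ¬? (z ℕ.≟ r))

  remove-length : ∀ {xs} → Unique xs → r ∈ xs → length xs ≡ suc (length (remove r xs))
  remove-length {x ∷ xs} (x∉xs ∷ _) (here refl) = cong (suc ∘ length) (sym (remove-head x∉xs))
  remove-length {x ∷ xs} (x∉xs ∷ u) (there r∈xs) with x ℕ.≟ r
  ... | yes refl = ⊥-elim (All¬⇒¬Any x∉xs r∈xs)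
  ... | no x≢r = cong suc (trans (remove-length u r∈xs) (cong length (sym (remove-tail x≢r))))

  ∏-remove : ∀ {xs} → Unique xs → r ∈ xs → ∏ xs ≡ + r * ∏ (remove r xs)
  ∏-remove {x ∷ xs} (x∉xs ∷ _) (here refl) = cong (λ ys → + x * ∏ ys) (sym (remove-head x∉xs))
  ∏-remove {x ∷ xs} (x∉xs ∷ u) (there r∈xs) with x ℕ.≟ r
  ... | yes refl = ⊥-elim (All¬⇒¬Any x∉xs r∈xs)
  ... | no x≢r = begin
    + x * ∏ xs                       ≡⟨ cong (+ x *_) (∏-remove u r∈xs) ⟩
    + x * (+ r * ∏ (remove r xs))    ≡⟨ swap (+ x) (+ r) (∏ (remove r xs)) ⟩
    + r * ∏ (x ∷ remove r xs)        ≡⟨ cong (λ ys → + r * ∏ ys) (sym (remove-tail x≢r)) ⟩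
    + r * ∏ (remove r (x ∷ xs))      ∎
    where
    open ≡-Reasoning
    swap : ∀ a b c → a * (b * c) ≡ b * (a * c)
    swap = solve-∀

module _ {p : ℕ} (p-prime : Prime p) {a : ℤ} (p∤a : ¬ + p ∣ a) where

  private
    P : ℤ
    P = + p

  cofactor-unique : ∀ {x y z} → y ℕ.< p → z ℕ.< p → P ∣ + y * + x - a → P ∣ + z * + x - a → y ≡ z
  cofactor-unique {x} {y} {z} y<p z<p yx≡a zx≡a =
    residue-injective y<p z<p ([ (λ p∣y-z → p∣y-z) , ⊥-elim ∘ p∤x ]′ (euclidsLemmaℤ p-prime (+ y - + z) (+ x) p∣[y-z]x))
    where
    p∣[y-z]x : P ∣ (+ y - + z) * + x
    p∣[y-z]x = ∣-combination yx≡a zx≡a (+ 1) (- (+ 1)) (difference (+ y) (+ z) (+ x) a)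
      where
      difference : ∀ y z x a → (y - z) * x ≡ + 1 * (y * x - a) + (- (+ 1)) * (z * x - a)
      difference = solve-∀
    p∤x : ¬ P ∣ + x
    p∤x p∣x = p∤a (∣-combination (∣n⇒∣m*n (+ y) p∣x) yx≡a (+ 1) (- (+ 1)) (split (+ y) (+ x) a))
      where
      split : ∀ y x a → a ≡ + 1 * (y * x) + (- (+ 1)) * (y * x - a)
      split = solve-∀

  record Paired (xs : List ℕ) : Set where
    field
      unique : Unique xs
      bounded : ∀ {x} → x ∈ xs → x ℕ.< p
      partner : ∀ {x} → x ∈ xs → ∃[ y ] y ∈ xs × P ∣ + x * + y - a
      no-fixed : ∀ {x} → x ∈ xs → ¬ P ∣ + x * + x - a

  private
    commute : ∀ {x y} → P ∣ + x * + y - a → P ∣ + y * + x - a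
    commute {x} {y} = subst (λ z → P ∣ z - a) (ℤP.*-comm (+ x) (+ y))

  other-partner : ∀ {x xs} → Paired (x ∷ xs) → ∃[ y ] y ∈ xs × P ∣ + x * + y - a
  other-partner paired with Paired.partner paired (here refl)
  ... | _ , here refl , x²≡a = ⊥-elim (Paired.no-fixed paired (here refl) x²≡a)
  ... | y , there y∈xs , xy≡a = y , y∈xs , xy≡a

  remove-partner : ∀ {x y xs} → Paired (x ∷ xs) → y ∈ xs → P ∣ + x * + y - a → Paired (remove y xs)
  remove-partner {x} {y} {xs} paired y∈xs xy≡a = record
    { unique = remove-unique (AllPairs.tail unique)
    ; bounded = bounded ∘ there ∘ proj₁ ∘ ∈-remove⁻
    ; partner = partner-in-rest
    ; no-fixed = no-fixed ∘ there ∘ proj₁ ∘ ∈-remove⁻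
    }
    where
    open Paired paired
    partner-in-rest : ∀ {z} → z ∈ remove y xs → ∃[ w ] w ∈ remove y xs × P ∣ + z * + w - a
    partner-in-rest {z} z∈ys with ∈-remove⁻ z∈ys
    ... | z∈xs , z≢y with partner (there z∈xs)
    ...   | _ , here refl , zx≡a = ⊥-elim (z≢y (cofactor-unique (bounded (there z∈xs)) (bounded (there y∈xs)) zx≡a (commute {x} {y} xy≡a)))
    ...   | w , there w∈xs , zw≡a with w ℕ.≟ y
    ...     | no w≢y = w , ∈-remove⁺ w∈xs w≢y , zw≡a
    ...     | yes refl = ⊥-elim (All¬⇒¬Any (AllPairs.head unique)
                                   (subst (_∈ xs) (cofactor-unique (bounded (there z∈xs)) (bounded (here refl)) zw≡a xy≡a) z∈xs))

  pairing : ∀ n xs → length xs ≡ n → Paired xs → ∃[ m ] 2 ℕ.* m ≡ n × P ∣ ∏ xs - a ^ m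
  pairing zero [] _ _ = 0 , refl , divides (+ 0) refl
  pairing (suc zero) (x ∷ []) _ paired with other-partner paired
  ... | _ , () , _
  pairing (suc (suc n)) (x ∷ xs) len paired with other-partner paired
  ... | y , y∈xs , xy≡a with pairing n (remove y xs) length-rest (remove-partner paired y∈xs xy≡a)
    where
    length-rest : length (remove y xs) ≡ n
    length-rest = ℕP.suc-injective (trans (sym (remove-length (AllPairs.tail (Paired.unique paired)) y∈xs)) (ℕP.suc-injective len))
  ...   | m , 2m≡n , ∏ys≡a^m = suc m , trans (ℕP.*-suc 2 m) (cong (2 ℕ.+_) 2m≡n) , ∣-combination xy≡a ∏ys≡a^m (∏ ys) a regroup
    where
    ys : List ℕ
    ys = remove y xs
    regroup : ∏ (x ∷ xs) - a ^ suc m ≡ ∏ ys * (+ x * + y - a) + a * (∏ ys - a ^ m)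
    regroup = trans (cong (λ z → + x * z - a * a ^ m) (∏-remove (AllPairs.tail (Paired.unique paired)) y∈xs)) (expand (+ x) (+ y) (∏ ys) a (a ^ m))
      where
      expand : ∀ x y Π a A → x * (y * Π) - a * A ≡ Π * (x * y - a) + a * (Π - A)
      expand = solve-∀

module _ {p : ℕ} (p-prime : Prime p) where

  private
    P : ℤ
    P = + p

  square? : ∀ a → (∃[ x ] P ∣ x * x - a) ⊎ (∀ x → ¬ P ∣ x * x - a)
  square? a with any? {n = p} (λ i → P ∣? (+ toℕ i * + toℕ i - a))
  ... | yes (i , i²≡a) = inj₁ (+ toℕ i , i²≡a)
  ... | no no-root = inj₂ λ x x²≡a → no-root (reduced x x²≡a (residue p {{prime⇒nonZero p-prime}} x))
    where
    reduced : ∀ x → P ∣ x * x - a → ∃[ r ] r ℕ.< p × P ∣ x - + r → ∃[ i ] P ∣ + toℕ {p} i * + toℕ i - a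
    reduced x x²≡a (r , r<p , x≡r) = fromℕ< r<p , subst (λ k → P ∣ + k * + k - a) (sym (toℕ-fromℕ< r<p)) (square-cong {x = x} x²≡a x≡r)

module _ {p h : ℕ} (p-prime : Prime p) (p≡2h+1 : p ≡ suc (2 ℕ.* h)) where

  private
    P : ℤ
    P = + p

  units : List ℕ
  units = applyUpTo suc (2 ℕ.* h)

  ∈-units⁻ : ∀ {z} → z ∈ units → 0 ℕ.< z × z ℕ.< p
  ∈-units⁻ z∈units with ∈-applyUpTo⁻ suc z∈units
  ... | i , i<2h , refl = s≤s z≤n , subst (suc i ℕ.<_) (sym p≡2h+1) (s≤s i<2h)

  ∈-units⁺ : ∀ {z} → 0 ℕ.< z → z ℕ.< p → z ∈ units
  ∈-units⁺ {suc i} _ z<p = ∈-applyUpTo⁺ suc (ℕP.≤-pred (subst (suc i ℕ.<_) p≡2h+1 z<p))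

  units-unique : Unique units
  units-unique = UniqueP.applyUpTo⁺₁ suc (2 ℕ.* h) (λ i<j _ → ℕP.<⇒≢ i<j ∘ ℕP.suc-injective)

  units-length : length units ≡ 2 ℕ.* h
  units-length = ListP.length-applyUpTo suc (2 ℕ.* h)

  partner-in-units : ∀ {a} → ¬ P ∣ a → ∀ {x} → x ∈ units → ∃[ y ] y ∈ units × P ∣ + x * + y - a
  partner-in-units {a} p∤a {x} x∈units with ∈-units⁻ x∈units
  ... | 0<x , x<p with inverse-mod p-prime (+ x) (prime∤residue p-prime 0<x x<p)
  ...   | b , xb≡1 with residue p {{prime⇒nonZero p-prime}} (b * a)
  ...     | y , y<p , ba≡y = y , ∈-units⁺ (ℕP.n≢0⇒n>0 y≢0) y<p , xy≡a
    where
    xy≡a : P ∣ + x * + y - a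
    xy≡a = ∣-combination xb≡1 ba≡y a (- (+ x)) (expand (+ x) (+ y) b a)
      where
      expand : ∀ x y b a → x * y - a ≡ a * (x * b - + 1) + (- x) * (b * a - y)
      expand = solve-∀
    y≢0 : y ≢ 0
    y≢0 refl = p∤a (subst (P ∣_) (vanish (+ x) a) (∣m⇒∣-m xy≡a))
      where
      vanish : ∀ x a → - (x * + 0 - a) ≡ a
      vanish = solve-∀

  ∏units≡a^h : ∀ {a} → ¬ P ∣ a → (∀ x → ¬ P ∣ x * x - a) → P ∣ ∏ units - a ^ h
  ∏units≡a^h {a} p∤a nonresidue with pairing p-prime p∤a (2 ℕ.* h) units units-length paired
    where
    paired : Paired p-prime p∤a units
    paired = record
      { unique = units-unique
      ; bounded = proj₂ ∘ ∈-units⁻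
      ; partner = partner-in-units p∤a
      ; no-fixed = λ {x} _ → nonresidue (+ x)
      }
  ... | m , 2m≡2h , p∣∏-a^m = subst (λ k → P ∣ ∏ units - a ^ k) (ℕP.*-cancelˡ-≡ m h 2 2m≡2h) p∣∏-a^m

  -- Only the two square roots r and p − r of a are their own cofactor, and r (p − r) ≡ −a.
  module _ {a : ℤ} {r : ℕ} (r∈units : r ∈ units) (r²≡a : P ∣ + r * + r - a) where

    private
      0<r : 0 ℕ.< r
      0<r = proj₁ (∈-units⁻ r∈units)

      r<p : r ℕ.< p
      r<p = proj₂ (∈-units⁻ r∈units)

      s : ℕ
      s = p ℕ.∸ r

      s≡p-r : + s ≡ P - + r
      s≡p-r = +-∸ (ℕP.<⇒≤ r<p)

      s∈units : s ∈ units
      s∈units = ∈-units⁺ (ℕP.m<n⇒0<n∸m r<p) (ℕP.∸-monoʳ-< 0<r (ℕP.<⇒≤ r<p))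

      s≢r : s ≢ r
      s≢r s≡r = ℕP.even≢odd r h (begin
        2 ℕ.* r      ≡⟨ cong (r ℕ.+_) (ℕP.+-identityʳ r) ⟩
        r ℕ.+ r      ≡⟨ cong (ℕ._+ r) s≡r ⟨
        s ℕ.+ r      ≡⟨ ℕP.m∸n+n≡m (ℕP.<⇒≤ r<p) ⟩
        p            ≡⟨ p≡2h+1 ⟩
        suc (2 ℕ.* h) ∎)
        where open ≡-Reasoning

      s²≡a : P ∣ + s * + s - a
      s²≡a = ∣-combination r²≡a (divides (P - + 2 * + r) refl) (+ 1) (+ 1) (trans (cong (λ x → x * x - a) s≡p-r) (expand P (+ r) a))
        where
        expand : ∀ P r a → (P - r) * (P - r) - a ≡ + 1 * (r * r - a) + + 1 * ((P - + 2 * r) * P)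
        expand = solve-∀

      p∤a : ¬ P ∣ a
      p∤a p∣a = prime∤residue p-prime 0<r r<p (prime∣²⇒∣ p-prime (∣-combination r²≡a p∣a (+ 1) (+ 1) (shift (+ r * + r) a)))
        where
        shift : ∀ x a → x ≡ + 1 * (x - a) + + 1 * a
        shift = solve-∀

      square-roots : ∀ {z} → z ℕ.< p → P ∣ + z * + z - a → z ≡ r ⊎ z ≡ s
      square-roots {z} z<p z²≡a
        with euclidsLemmaℤ p-prime (+ z - + r) (+ z + + r) (∣-combination z²≡a r²≡a (+ 1) (- (+ 1)) (factor (+ z) (+ r) a))
        where
        factor : ∀ z r a → (z - r) * (z + r) ≡ + 1 * (z * z - a) + (- (+ 1)) * (r * r - a)
        factor = solve-∀
      ... | inj₁ p∣z-r = inj₁ (residue-injective z<p r<p p∣z-r)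
      ... | inj₂ p∣z+r = inj₂ (residue-negation z<p 0<r (ℕP.<⇒≤ r<p) p∣z+r)

      rest : List ℕ
      rest = remove s (remove r units)

      ∈-rest⁻ : ∀ {z} → z ∈ rest → z ∈ units × z ≢ r × z ≢ s
      ∈-rest⁻ z∈rest with ∈-remove⁻ z∈rest
      ... | z∈units-r , z≢s with ∈-remove⁻ z∈units-r
      ...   | z∈units , z≢r = z∈units , z≢r , z≢s

      ∈-rest⁺ : ∀ {z} → z ∈ units → z ≢ r → z ≢ s → z ∈ rest
      ∈-rest⁺ z∈units z≢r z≢s = ∈-remove⁺ (∈-remove⁺ z∈units z≢r) z≢s

      rest-paired : Paired p-prime p∤a rest
      rest-paired = record
        { unique = remove-unique (remove-unique units-unique)
        ; bounded = proj₂ ∘ ∈-units⁻ ∘ proj₁ ∘ ∈-rest⁻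
        ; partner = partner-in-rest
        ; no-fixed = no-root-in-rest
        }
        where
        bounded : ∀ {z} → z ∈ units → z ℕ.< p
        bounded = proj₂ ∘ ∈-units⁻
        no-root-in-rest : ∀ {z} → z ∈ rest → ¬ P ∣ + z * + z - a
        no-root-in-rest z∈rest z²≡a with ∈-rest⁻ z∈rest
        ... | z∈units , z≢r , z≢s = [ z≢r , z≢s ]′ (square-roots (bounded z∈units) z²≡a)
        partner-in-rest : ∀ {z} → z ∈ rest → ∃[ w ] w ∈ rest × P ∣ + z * + w - a
        partner-in-rest z∈rest = keep (∈-rest⁻ z∈rest) (partner-in-units p∤a (proj₁ (∈-rest⁻ z∈rest)))
          where
          keep : ∀ {z} → z ∈ units × z ≢ r × z ≢ s → ∃[ w ] w ∈ units × P ∣ + z * + w - a → ∃[ w ] w ∈ rest × P ∣ + z * + w - a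
          keep {z} (z∈units , z≢r , z≢s) (w , w∈units , zw≡a) = w , ∈-rest⁺ w∈units w≢r w≢s , zw≡a
            where
            w≢r : w ≢ r
            w≢r w≡r = z≢r (cofactor-unique p-prime p∤a (bounded z∈units) r<p (subst (λ v → P ∣ + z * + v - a) w≡r zw≡a) r²≡a)
            w≢s : w ≢ s
            w≢s w≡s = z≢s (cofactor-unique p-prime p∤a (bounded z∈units) (bounded s∈units)
                                            (subst (λ v → P ∣ + z * + v - a) w≡s zw≡a) s²≡a)

      length-rest : 2 ℕ.* h ≡ suc (suc (length rest))
      length-rest = trans (sym units-length) (trans (remove-length units-unique r∈units)
                      (cong suc (remove-length (remove-unique units-unique) (∈-remove⁺ s∈units s≢r))))

      ∏units≡rs∏rest : ∏ units ≡ + r * (+ s * ∏ rest)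
      ∏units≡rs∏rest = trans (∏-remove units-unique r∈units)
                         (cong (+ r *_) (∏-remove (remove-unique units-unique) (∈-remove⁺ s∈units s≢r)))

    ∏units≡-a^h : P ∣ ∏ units + a ^ h
    ∏units≡-a^h = from-pairing (pairing p-prime p∤a (length rest) rest refl rest-paired)
      where
      from-pairing : ∃[ m ] 2 ℕ.* m ≡ length rest × P ∣ ∏ rest - a ^ m → P ∣ ∏ units + a ^ h
      from-pairing (m , 2m≡|rest| , ∏rest≡a^m) = subst (λ k → P ∣ ∏ units + a ^ k) 1+m≡h
          (subst (P ∣_) (sym expansion) (∣m∣n⇒∣m+n (∣-combination r²≡a ∏rest≡a^m (- ∏ rest) (- a) refl) (divides (+ r * ∏ rest) refl)))
        where
        1+m≡h : suc m ≡ h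
        1+m≡h = ℕP.*-cancelˡ-≡ (suc m) h 2 (trans (ℕP.*-suc 2 m) (trans (cong (2 ℕ.+_) 2m≡|rest|) (sym length-rest)))
        expansion : ∏ units + a * a ^ m ≡ (- ∏ rest) * (+ r * + r - a) + (- a) * (∏ rest - a ^ m) + (+ r * ∏ rest) * P
        expansion = begin
          ∏ units + a * a ^ m                     ≡⟨ cong (λ x → x + a * a ^ m) ∏units≡rs∏rest ⟩
          + r * (+ s * ∏ rest) + a * a ^ m        ≡⟨ cong (λ x → + r * (x * ∏ rest) + a * a ^ m) s≡p-r ⟩
          + r * ((P - + r) * ∏ rest) + a * a ^ m  ≡⟨ regroup (+ r) P (∏ rest) a (a ^ m) ⟩
          (- ∏ rest) * (+ r * + r - a) + (- a) * (∏ rest - a ^ m) + (+ r * ∏ rest) * P ∎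
          where
          open ≡-Reasoning
          regroup : ∀ r P Π a A → r * ((P - r) * Π) + a * A ≡ (- Π) * (r * r - a) + (- a) * (Π - A) + (r * Π) * P
          regroup = solve-∀

  private
    residue-root : ∀ {a x} → ¬ P ∣ a → P ∣ x * x - a → ∃[ r ] r ∈ units × P ∣ + r * + r - a
    residue-root {a} {x} p∤a x²≡a with residue p {{prime⇒nonZero p-prime}} x
    ... | r , r<p , x≡r = r , ∈-units⁺ (ℕP.n≢0⇒n>0 r≢0) r<p , r²≡a
      where
      r²≡a : P ∣ + r * + r - a
      r²≡a = square-cong {x = x} x²≡a x≡r
      r≢0 : r ≢ 0
      r≢0 refl = p∤a (subst (P ∣_) (ℤP.neg-involutive a) (∣m⇒∣-m (subst (P ∣_) (ℤP.+-identityˡ (- a)) r²≡a)))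

  wilson : P ∣ ∏ units + + 1
  wilson = subst (λ x → P ∣ ∏ units + x) (ℤP.^-zeroˡ h) (∏units≡-a^h (∈-units⁺ (s≤s z≤n) (prime>1 p-prime)) (divides (+ 0) refl))

  euler-residue : ∀ {a x} → ¬ P ∣ a → P ∣ x * x - a → P ∣ a ^ h - + 1
  euler-residue {a} {x} p∤a x²≡a with residue-root {x = x} p∤a x²≡a
  ... | r , r∈units , r²≡a = ∣-combination (∏units≡-a^h r∈units r²≡a) wilson (+ 1) (- (+ 1)) (difference (∏ units) (a ^ h))
    where
    difference : ∀ Π A → A - + 1 ≡ + 1 * (Π + A) + (- (+ 1)) * (Π + + 1)
    difference = solve-∀

  euler-nonresidue : ∀ {a} → ¬ P ∣ a → (∀ x → ¬ P ∣ x * x - a) → P ∣ a ^ h + + 1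
  euler-nonresidue {a} p∤a nonresidue = ∣-combination wilson (∏units≡a^h p∤a nonresidue) (+ 1) (- (+ 1)) (difference (∏ units) (a ^ h))
    where
    difference : ∀ Π A → A + + 1 ≡ + 1 * (Π + + 1) + (- (+ 1)) * (Π - A)
    difference = solve-∀

-- The supplementary law for (−2/p)

∏< : ℕ → (ℕ → ℤ) → ℤ
∏< zero f = + 1
∏< (suc n) f = ∏< n f * f n

∏<-cong : ∀ n {f g} → (∀ {i} → i ℕ.< n → f i ≡ g i) → ∏< n f ≡ ∏< n g
∏<-cong zero _ = refl
∏<-cong (suc n) f≡g = cong₂ _*_ (∏<-cong n (f≡g ∘ ℕP.m<n⇒m<1+n)) (f≡g (ℕP.n<1+n n))

∏<-+ : ∀ m n f → ∏< (m ℕ.+ n) f ≡ ∏< m f * ∏< n (λ i → f (m ℕ.+ i))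
∏<-+ m zero f = trans (cong (λ k → ∏< k f) (ℕP.+-identityʳ m)) (sym (ℤP.*-identityʳ (∏< m f)))
∏<-+ m (suc n) f = begin
  ∏< (m ℕ.+ suc n) f                                          ≡⟨ cong (λ k → ∏< k f) (ℕP.+-suc m n) ⟩
  ∏< (m ℕ.+ n) f * f (m ℕ.+ n)                                ≡⟨ cong (_* f (m ℕ.+ n)) (∏<-+ m n f) ⟩
  ∏< m f * ∏< n (λ i → f (m ℕ.+ i)) * f (m ℕ.+ n)             ≡⟨ ℤP.*-assoc (∏< m f) _ _ ⟩
  ∏< m f * (∏< n (λ i → f (m ℕ.+ i)) * f (m ℕ.+ n))           ∎
  where open ≡-Reasoning

∏<-scale : ∀ n c f → ∏< n (λ i → c * f i) ≡ c ^ n * ∏< n f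
∏<-scale zero c f = refl
∏<-scale (suc n) c f = trans (cong (_* (c * f n)) (∏<-scale n c f)) (regroup c (c ^ n) (∏< n f) (f n))
  where
  regroup : ∀ c C Π x → C * Π * (c * x) ≡ c * C * (Π * x)
  regroup = solve-∀

∏<-suc : ∀ n f → ∏< (suc n) f ≡ f 0 * ∏< n (λ i → f (suc i))
∏<-suc zero f = trans (ℤP.*-identityˡ (f 0)) (sym (ℤP.*-identityʳ (f 0)))
∏<-suc (suc n) f = trans (cong (_* f (suc n)) (∏<-suc n f)) (ℤP.*-assoc (f 0) _ _)

∏<-reverse : ∀ n f → ∏< n f ≡ ∏< n (λ i → f (n ℕ.∸ suc i))
∏<-reverse zero f = refl
∏<-reverse (suc n) f = begin
  ∏< n f * f n                                  ≡⟨ cong (_* f n) (∏<-reverse n f) ⟩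
  ∏< n (λ i → f (n ℕ.∸ suc i)) * f n            ≡⟨ ℤP.*-comm _ (f n) ⟩
  f n * ∏< n (λ i → f (n ℕ.∸ suc i))            ≡⟨ ∏<-suc n (λ i → f (suc n ℕ.∸ suc i)) ⟨
  ∏< (suc n) (λ i → f (suc n ℕ.∸ suc i))        ∎
  where open ≡-Reasoning

∏<-cong-mod : ∀ {k} n f g c → (∀ {i} → i ℕ.< n → k ∣ f i - c * g i) → k ∣ ∏< n f - c ^ n * ∏< n g
∏<-cong-mod zero f g c _ = divides (+ 0) refl
∏<-cong-mod (suc n) f g c f≡cg =
  ∣-combination (∏<-cong-mod n f g c (f≡cg ∘ ℕP.m<n⇒m<1+n)) (f≡cg (ℕP.n<1+n n)) (f n) (c ^ n * ∏< n g)
                (regroup (∏< n f) (f n) c (c ^ n) (∏< n g) (g n))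
  where
  regroup : ∀ F f c C G g → F * f - c * C * (G * g) ≡ f * (F - C * G) + C * G * (f - c * g)
  regroup = solve-∀

factorial : ℕ → ℤ
factorial n = ∏< n (λ i → + suc i)

evens : ℕ → ℤ
evens n = ∏< n (λ i → + 2 * + suc i)

odds : ℕ → ℤ
odds n = ∏< n (λ i → + suc (2 ℕ.* i))

mutual
  factorial-even : ∀ g → factorial (g ℕ.+ g) ≡ evens g * odds g
  factorial-even zero = refl
  factorial-even (suc g) = begin
    factorial (suc g ℕ.+ suc g)                    ≡⟨ cong factorial (ℕP.+-suc (suc g) g) ⟩
    factorial (suc g ℕ.+ g) * + suc (suc g ℕ.+ g)  ≡⟨ cong₂ _*_ (factorial-odd g) (doubled g) ⟩
    evens g * odds (suc g) * (+ 2 * + suc g)        ≡⟨ swap (evens g) (odds (suc g)) (+ 2 * + suc g) ⟩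
    evens (suc g) * odds (suc g)                    ∎
    where
    open ≡-Reasoning
    doubled : ∀ g → + suc (suc g ℕ.+ g) ≡ + 2 * + suc g
    doubled g = trans (cong +_ (double g)) (ℤP.pos-* 2 (suc g))
      where
      double : ∀ g → suc (suc g ℕ.+ g) ≡ 2 ℕ.* suc g
      double = ℕ-Solver.solve-∀
    swap : ∀ E O x → E * O * x ≡ E * x * O
    swap = solve-∀

  factorial-odd : ∀ g → factorial (suc g ℕ.+ g) ≡ evens g * odds (suc g)
  factorial-odd g = begin
    factorial (g ℕ.+ g) * + suc (g ℕ.+ g)          ≡⟨ cong (_* + suc (g ℕ.+ g)) (factorial-even g) ⟩
    evens g * odds g * + suc (g ℕ.+ g)             ≡⟨ cong (λ k → evens g * odds g * + suc (g ℕ.+ k)) (sym (ℕP.+-identityʳ g)) ⟩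
    evens g * odds g * + suc (2 ℕ.* g)             ≡⟨ ℤP.*-assoc (evens g) (odds g) _ ⟩
    evens g * odds (suc g)                          ∎
    where open ≡-Reasoning

factorial-split : ∀ g m → (m ≡ g ⊎ m ≡ suc g) → factorial (g ℕ.+ m) ≡ evens g * odds m
factorial-split g m (inj₁ m≡g) = subst (λ k → factorial (g ℕ.+ k) ≡ evens g * odds k) (sym m≡g) (factorial-even g)
factorial-split g m (inj₂ m≡g+1) = subst (λ k → factorial (g ℕ.+ k) ≡ evens g * odds k) (sym m≡g+1)
                                     (trans (cong factorial (ℕP.+-suc g g)) (factorial-odd g))

prime∤factorial : ∀ {p} → Prime p → ∀ n → n ℕ.< p → ¬ + p ∣ factorial n
prime∤factorial p-prime zero _ = prime∤1 p-prime
prime∤factorial p-prime (suc n) n<p =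
  prime∤* p-prime (prime∤factorial p-prime n (ℕP.<-trans (ℕP.n<1+n n) n<p)) (prime∤residue p-prime (s≤s z≤n) n<p)

module _ {p h : ℕ} (p-prime : Prime p) (p≡2h+1 : p ≡ suc (2 ℕ.* h)) where

  private
    P : ℤ
    P = + p

  negated-evens : ∀ g m → h ≡ g ℕ.+ m → ∏< m (λ i → P - + 2 * + suc (g ℕ.+ i)) ≡ odds m
  negated-evens g m refl = trans (∏<-cong m reflect) (sym (∏<-reverse m (λ i → + suc (2 ℕ.* i))))
    where
    reflect : ∀ {i} → i ℕ.< m → P - + 2 * + suc (g ℕ.+ i) ≡ + suc (2 ℕ.* (m ℕ.∸ suc i))
    reflect {i} i<m with ℕP.m≤n⇒∃[o]m+o≡n i<m
    ... | d , i+1+d≡m = begin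
      P - + 2 * + suc (g ℕ.+ i)                                     ≡⟨ cong (λ n → + n - + 2 * + suc (g ℕ.+ i)) p≡ ⟩
      + (2 ℕ.* suc (g ℕ.+ i) ℕ.+ suc (2 ℕ.* d)) - + 2 * + suc (g ℕ.+ i) ≡⟨ cancel (suc (g ℕ.+ i)) (suc (2 ℕ.* d)) ⟩
      + suc (2 ℕ.* d)                                                ≡⟨ cong (λ k → + suc (2 ℕ.* k)) d≡m-1-i ⟩
      + suc (2 ℕ.* (m ℕ.∸ suc i))                                    ∎
      where
      open ≡-Reasoning
      d≡m-1-i : d ≡ m ℕ.∸ suc i
      d≡m-1-i = trans (sym (ℕP.m+n∸m≡n (suc i) d)) (cong (ℕ._∸ suc i) i+1+d≡m)
      p≡ : p ≡ 2 ℕ.* suc (g ℕ.+ i) ℕ.+ suc (2 ℕ.* d)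
      p≡ = trans p≡2h+1 (trans (cong (λ k → suc (2 ℕ.* (g ℕ.+ k))) (sym i+1+d≡m)) (split g i d))
        where
        split : ∀ g i d → suc (2 ℕ.* (g ℕ.+ (suc i ℕ.+ d))) ≡ 2 ℕ.* suc (g ℕ.+ i) ℕ.+ suc (2 ℕ.* d)
        split = ℕ-Solver.solve-∀
      cancel : ∀ c b → + (2 ℕ.* c ℕ.+ b) - + 2 * + c ≡ + b
      cancel c b = trans (cong (λ z → + (2 ℕ.* c ℕ.+ b) - z) (sym (ℤP.pos-* 2 c))) (+[m+n]-m≡n (2 ℕ.* c) b)

  -- Gauss: 2^h h! = 2·4⋯2h; its m factors 2i > h are ≡ −(p − 2i), and these p − 2i are the odd
  -- numbers below h.
  2^h≡±1 : ∀ g m → (m ≡ g ⊎ m ≡ suc g) → h ≡ g ℕ.+ m → P ∣ (+ 2) ^ h - (- (+ 1)) ^ m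
  2^h≡±1 g m m≡g∨g+1 refl =
    [ (λ p∣2^h-σ → p∣2^h-σ) , ⊥-elim ∘ prime∤factorial p-prime h h<p ]′ (euclidsLemmaℤ p-prime _ (factorial h) p∣[2^h-σ]h!)
    where
    σ : ℤ
    σ = (- (+ 1)) ^ m
    h<p : h ℕ.< p
    h<p = subst (h ℕ.<_) (sym p≡2h+1) (s≤s (ℕP.m≤n*m h 2))
    large : ℤ
    large = ∏< m (λ i → + 2 * + suc (g ℕ.+ i))
    negated : ℤ
    negated = ∏< m (λ i → P - + 2 * + suc (g ℕ.+ i))
    large≡σnegated : P ∣ large - σ * negated
    large≡σnegated = ∏<-cong-mod m _ _ (- (+ 1)) (λ {i} _ → divides (+ 1) (cancel (+ 2 * + suc (g ℕ.+ i)) P))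
      where
      cancel : ∀ x P → x - (- (+ 1)) * (P - x) ≡ + 1 * P
      cancel = solve-∀
    2^hh!≡evens*large : (+ 2) ^ h * factorial h ≡ evens g * large
    2^hh!≡evens*large = trans (sym (∏<-scale h (+ 2) (λ i → + suc i))) (∏<-+ g m (λ i → + 2 * + suc i))
    h!≡evens*negated : factorial h ≡ evens g * negated
    h!≡evens*negated = trans (factorial-split g m m≡g∨g+1) (cong (evens g *_) (sym (negated-evens g m refl)))
    p∣[2^h-σ]h! : P ∣ ((+ 2) ^ h - σ) * factorial h
    p∣[2^h-σ]h! = subst (P ∣_) (sym factored) (∣n⇒∣m*n (evens g) large≡σnegated)
      where
      factored : ((+ 2) ^ h - σ) * factorial h ≡ evens g * (large - σ * negated)
      factored = begin
        ((+ 2) ^ h - σ) * factorial h                   ≡⟨ distrib ((+ 2) ^ h) σ (factorial h) ⟩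
        (+ 2) ^ h * factorial h - σ * factorial h       ≡⟨ cong₂ (λ x y → x - σ * y) 2^hh!≡evens*large h!≡evens*negated ⟩
        evens g * large - σ * (evens g * negated)       ≡⟨ regroup (evens g) large σ negated ⟩
        evens g * (large - σ * negated)                 ∎
        where
        open ≡-Reasoning
        distrib : ∀ x σ F → (x - σ) * F ≡ x * F - σ * F
        distrib = solve-∀
        regroup : ∀ E A σ N → E * A - σ * (E * N) ≡ E * (A - σ * N)
        regroup = solve-∀

*-^ : ∀ x y n → (x * y) ^ n ≡ x ^ n * y ^ n
*-^ x y zero = refl
*-^ x y (suc n) = trans (cong (x * y *_) (*-^ x y n)) (regroup x y (x ^ n) (y ^ n))
  where
  regroup : ∀ x y X Y → x * y * (X * Y) ≡ x * X * (y * Y)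
  regroup = solve-∀

-1^-+even : ∀ g k → (- (+ 1)) ^ (g ℕ.+ 2 ℕ.* k) ≡ (- (+ 1)) ^ g
-1^-+even g k = begin
  (- (+ 1)) ^ (g ℕ.+ 2 ℕ.* k)              ≡⟨ ℤP.^-distribˡ-+-* (- (+ 1)) g (2 ℕ.* k) ⟩
  (- (+ 1)) ^ g * (- (+ 1)) ^ (2 ℕ.* k)    ≡⟨ cong ((- (+ 1)) ^ g *_) (ℤP.^-*-assoc (- (+ 1)) 2 k) ⟨
  (- (+ 1)) ^ g * (+ 1) ^ k                ≡⟨ cong ((- (+ 1)) ^ g *_) (ℤP.^-zeroˡ k) ⟩
  (- (+ 1)) ^ g * + 1                      ≡⟨ ℤP.*-identityʳ _ ⟩
  (- (+ 1)) ^ g                            ∎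
  where open ≡-Reasoning

module _ {p : ℕ} (p-prime : Prime p) (p≢2 : p ≢ 2) where

  private
    P : ℤ
    P = + p

  odd-prime∤2 : ¬ P ∣ + 2
  odd-prime∤2 = prime∤residue p-prime (s≤s z≤n) (ℕP.≤∧≢⇒< (prime>1 p-prime) (p≢2 ∘ sym))

  LegendreOne-2⇔root : LegendreOne -[1+ 1 ] p ⇔ -2IsSquareMod p
  LegendreOne-2⇔root = mk⇔ (λ (_ , x , p∣x²+2) → x , subst (P ∣_) (square x) (∣ᵤ⇒∣ p∣x²+2))
                           (λ (x , p∣x²+2) → p∤-2 , x , ∣⇒∣ᵤ (subst (P ∣_) (sym (square x)) p∣x²+2))
    where
    p∤-2 : ¬ P ℤD.∣ -[1+ 1 ]
    p∤-2 p∣-2 = odd-prime∤2 (∣m⇒∣-m {m = -[1+ 1 ]} (∣ᵤ⇒∣ p∣-2))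
    square : ∀ x → x ^ 2 - -[1+ 1 ] ≡ x * x + + 2
    square x = cong (λ y → x * y + + 2) (ℤP.*-identityʳ x)

  module _ {h : ℕ} (p≡2h+1 : p ≡ suc (2 ℕ.* h)) where

    -2^h≡-1^g : ∀ g e → e ℕ.≤ 1 → h ≡ 2 ℕ.* g ℕ.+ e → P ∣ -[1+ 1 ] ^ h - (- (+ 1)) ^ g
    -2^h≡-1^g g e e≤1 h≡2g+e = subst (P ∣_) (sym expansion) (∣n⇒∣m*n ((- (+ 1)) ^ h) 2^h≡-1^m)
      where
      m : ℕ
      m = g ℕ.+ e
      h≡g+m : h ≡ g ℕ.+ m
      h≡g+m = trans h≡2g+e (regroup g e)
        where
        regroup : ∀ g e → 2 ℕ.* g ℕ.+ e ≡ g ℕ.+ (g ℕ.+ e)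
        regroup = ℕ-Solver.solve-∀
      m≡g∨g+1 : ∀ {e} → e ℕ.≤ 1 → g ℕ.+ e ≡ g ⊎ g ℕ.+ e ≡ suc g
      m≡g∨g+1 z≤n = inj₁ (ℕP.+-identityʳ g)
      m≡g∨g+1 (s≤s z≤n) = inj₂ (ℕP.+-comm g 1)
      2^h≡-1^m : P ∣ (+ 2) ^ h - (- (+ 1)) ^ m
      2^h≡-1^m = 2^h≡±1 {h = h} p-prime p≡2h+1 g m (m≡g∨g+1 e≤1) h≡g+m
      expansion : -[1+ 1 ] ^ h - (- (+ 1)) ^ g ≡ (- (+ 1)) ^ h * ((+ 2) ^ h - (- (+ 1)) ^ m)
      expansion = begin
        -[1+ 1 ] ^ h - (- (+ 1)) ^ g                       ≡⟨ cong₂ _-_ (*-^ (- (+ 1)) (+ 2) h) (sym (-1^-+even g m)) ⟩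
        (- (+ 1)) ^ h * (+ 2) ^ h - (- (+ 1)) ^ (g ℕ.+ 2 ℕ.* m) ≡⟨ cong (λ k → (- (+ 1)) ^ h * (+ 2) ^ h - (- (+ 1)) ^ k) g+2m≡h+m ⟩
        (- (+ 1)) ^ h * (+ 2) ^ h - (- (+ 1)) ^ (h ℕ.+ m)  ≡⟨ cong (λ x → (- (+ 1)) ^ h * (+ 2) ^ h - x) (ℤP.^-distribˡ-+-* (- (+ 1)) h m) ⟩
        (- (+ 1)) ^ h * (+ 2) ^ h - (- (+ 1)) ^ h * (- (+ 1)) ^ m ≡⟨ factor ((- (+ 1)) ^ h) ((+ 2) ^ h) ((- (+ 1)) ^ m) ⟩
        (- (+ 1)) ^ h * ((+ 2) ^ h - (- (+ 1)) ^ m)        ∎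
        where
        open ≡-Reasoning
        g+2m≡h+m : g ℕ.+ 2 ℕ.* m ≡ h ℕ.+ m
        g+2m≡h+m = trans (regroup g m) (cong (ℕ._+ m) (sym h≡g+m))
          where
          regroup : ∀ g m → g ℕ.+ 2 ℕ.* m ≡ g ℕ.+ m ℕ.+ m
          regroup = ℕ-Solver.solve-∀
        factor : ∀ s x y → s * x - s * y ≡ s * (x - y)
        factor = solve-∀

    private
      p∤-2 : ¬ P ∣ -[1+ 1 ]
      p∤-2 = odd-prime∤2 ∘ ∣m⇒∣-m

      ±1-distinct : ∀ {A} → P ∣ A - + 1 → P ∣ A + + 1 → ⊥
      ±1-distinct {A} A≡1 A≡-1 = odd-prime∤2 (∣-combination A≡-1 A≡1 (+ 1) (- (+ 1)) (difference A))
        where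
        difference : ∀ A → + 2 ≡ + 1 * (A + + 1) + (- (+ 1)) * (A - + 1)
        difference = solve-∀

    -2-square-if : P ∣ -[1+ 1 ] ^ h - + 1 → -2IsSquareMod p
    -2-square-if -2^h≡1 with square? p-prime -[1+ 1 ]
    ... | inj₁ root = root
    ... | inj₂ nonresidue = ⊥-elim (±1-distinct {A = -[1+ 1 ] ^ h} -2^h≡1 (euler-nonresidue {h = h} p-prime p≡2h+1 p∤-2 nonresidue))

    -2-nonsquare-if : P ∣ -[1+ 1 ] ^ h + + 1 → ¬ -2IsSquareMod p
    -2-nonsquare-if -2^h≡-1 (x , x²≡-2) = ±1-distinct {A = -[1+ 1 ] ^ h} (euler-residue {h = h} p-prime p≡2h+1 {x = x} p∤-2 x²≡-2) -2^h≡-1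

  private
    p-odd : ∀ k → p ≢ k ℕ.* 2
    p-odd k p≡2k with prime⇒irreducible p-prime (ℕD.divides k p≡2k)
    ... | inj₁ ()
    ... | inj₂ 2≡p = p≢2 (sym 2≡p)

    -- For p = 8t + r and h = (p − 1)/2 = 2g + e, the sign (−1)^g of (−2)^h depends on r only.
    square-class : ∀ t e → e ℕ.≤ 1 → p ≡ suc (2 ℕ.* (2 ℕ.* (2 ℕ.* t) ℕ.+ e)) → -2IsSquareMod p
    square-class t e e≤1 p≡2h+1 =
      -2-square-if {h} p≡2h+1 (subst (λ σ → P ∣ -[1+ 1 ] ^ h - σ) (-1^-+even 0 t) (-2^h≡-1^g {h} p≡2h+1 (2 ℕ.* t) e e≤1 refl))
      where
      h : ℕ
      h = 2 ℕ.* (2 ℕ.* t) ℕ.+ e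

    nonsquare-class : ∀ t e → e ℕ.≤ 1 → p ≡ suc (2 ℕ.* (2 ℕ.* (1 ℕ.+ 2 ℕ.* t) ℕ.+ e)) → ¬ -2IsSquareMod p
    nonsquare-class t e e≤1 p≡2h+1 =
      -2-nonsquare-if {h} p≡2h+1 (subst (λ σ → P ∣ -[1+ 1 ] ^ h - σ) (-1^-+even 1 t) (-2^h≡-1^g {h} p≡2h+1 (1 ℕ.+ 2 ℕ.* t) e e≤1 refl))
      where
      h : ℕ
      h = 2 ℕ.* (1 ℕ.+ 2 ℕ.* t) ℕ.+ e

  -2-square⇔ : ∀ r t → p ≡ r ℕ.+ t ℕ.* 8 → r ℕ.< 8 → -2IsSquareMod p ⇔ (r ≡ 1 ⊎ r ≡ 3)
  -2-square⇔ 0 t p≡8t _ = ⊥-elim (p-odd (t ℕ.* 4) (trans p≡8t (shape t)))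
    where
    shape : ∀ t → 0 ℕ.+ t ℕ.* 8 ≡ t ℕ.* 4 ℕ.* 2
    shape = ℕ-Solver.solve-∀
  -2-square⇔ 1 t p≡1+8t _ = mk⇔ (λ _ → inj₁ refl) (λ _ → square-class t 0 z≤n (trans p≡1+8t (shape t)))
    where
    shape : ∀ t → 1 ℕ.+ t ℕ.* 8 ≡ suc (2 ℕ.* (2 ℕ.* (2 ℕ.* t) ℕ.+ 0))
    shape = ℕ-Solver.solve-∀
  -2-square⇔ 2 t p≡2+8t _ = ⊥-elim (p-odd (1 ℕ.+ t ℕ.* 4) (trans p≡2+8t (shape t)))
    where
    shape : ∀ t → 2 ℕ.+ t ℕ.* 8 ≡ (1 ℕ.+ t ℕ.* 4) ℕ.* 2
    shape = ℕ-Solver.solve-∀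
  -2-square⇔ 3 t p≡3+8t _ = mk⇔ (λ _ → inj₂ refl) (λ _ → square-class t 1 (s≤s z≤n) (trans p≡3+8t (shape t)))
    where
    shape : ∀ t → 3 ℕ.+ t ℕ.* 8 ≡ suc (2 ℕ.* (2 ℕ.* (2 ℕ.* t) ℕ.+ 1))
    shape = ℕ-Solver.solve-∀
  -2-square⇔ 4 t p≡4+8t _ = ⊥-elim (p-odd (2 ℕ.+ t ℕ.* 4) (trans p≡4+8t (shape t)))
    where
    shape : ∀ t → 4 ℕ.+ t ℕ.* 8 ≡ (2 ℕ.+ t ℕ.* 4) ℕ.* 2
    shape = ℕ-Solver.solve-∀
  -2-square⇔ 5 t p≡5+8t _ = mk⇔ (⊥-elim ∘ nonsquare-class t 0 z≤n (trans p≡5+8t (shape t))) (λ { (inj₁ ()) ; (inj₂ ()) })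
    where
    shape : ∀ t → 5 ℕ.+ t ℕ.* 8 ≡ suc (2 ℕ.* (2 ℕ.* (1 ℕ.+ 2 ℕ.* t) ℕ.+ 0))
    shape = ℕ-Solver.solve-∀
  -2-square⇔ 6 t p≡6+8t _ = ⊥-elim (p-odd (3 ℕ.+ t ℕ.* 4) (trans p≡6+8t (shape t)))
    where
    shape : ∀ t → 6 ℕ.+ t ℕ.* 8 ≡ (3 ℕ.+ t ℕ.* 4) ℕ.* 2
    shape = ℕ-Solver.solve-∀
  -2-square⇔ 7 t p≡7+8t _ = mk⇔ (⊥-elim ∘ nonsquare-class t 1 (s≤s z≤n) (trans p≡7+8t (shape t))) (λ { (inj₁ ()) ; (inj₂ ()) })
    where
    shape : ∀ t → 7 ℕ.+ t ℕ.* 8 ≡ suc (2 ℕ.* (2 ℕ.* (1 ℕ.+ 2 ℕ.* t) ℕ.+ 1))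
    shape = ℕ-Solver.solve-∀
  -2-square⇔ (suc (suc (suc (suc (suc (suc (suc (suc _)))))))) _ _ (s≤s (s≤s (s≤s (s≤s (s≤s (s≤s (s≤s (s≤s ()))))))))

  -2-residue⇔ : LegendreOne -[1+ 1 ] p ⇔ (p ℕ.% 8 ≡ 1 ⊎ p ℕ.% 8 ≡ 3)
  -2-residue⇔ = -2-square⇔ (p ℕ.% 8) (p ℕ./ 8) (ℕDM.m≡m%n+[m/n]*n p 8) (ℕDM.m%n<n p 8) ⇔-∘ LegendreOne-2⇔root

-- Twin primes

module _ {ℓ : ℕ} (ℓ-prime : Prime ℓ) (ℓ≢2 : ℓ ≢ 2) where

  private
    L : ℤ
    L = + ℓ

  -2-sqrt : -2IsSquareMod ℓ → HasSqrt ℓ -[1+ 1 ]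
  -2-sqrt (t , t²≡-2) = hensel-odd ℓ-prime {c = -[1+ 1 ]} t²≡-2 (prime∤* ℓ-prime (odd-prime∤2 ℓ-prime ℓ≢2) ℓ∤t)
    where
    ℓ∤t : ¬ L ∣ t
    ℓ∤t ℓ∣t = odd-prime∤2 ℓ-prime ℓ≢2 (∣-combination t²≡-2 (∣m⇒∣m*n t ℓ∣t) (+ 1) (- (+ 1)) (difference t))
      where
      difference : ∀ t → + 2 ≡ + 1 * (t * t + + 2) + (- (+ 1)) * (t * t)
      difference = solve-∀

  local-solubility : ∀ {ε} → ε * ε ≡ + 1 → HasQvPoint (+ 4 * ε + + 4 * L) ℓ ⇔ LegendreOne -[1+ 1 ] ℓ
  local-solubility {ε} ε²≡1 = mk⇔ (Equivalence.from legendre ∘ descent ℓ-prime (odd-prime∤2 ℓ-prime ℓ≢2) {ε} ε²≡1)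
                                  (point-at-0 (+ 4 * ε + + 4 * L) ℓ ∘ -2-sqrt ∘ Equivalence.to legendre)
    where
    legendre : LegendreOne -[1+ 1 ] ℓ ⇔ -2IsSquareMod ℓ
    legendre = LegendreOne-2⇔root ℓ-prime ℓ≢2

point-over-ℚ₂ : ∀ p → p ℕ.% 8 ≡ 1 → HasQvPoint (+ (2 ℕ.* (p ℕ.+ (p ℕ.+ 2)))) 2
point-over-ℚ₂ p p≡1 = point-at-1 s 2 (subst (HasSqrt 2) s-4≡4p (sqrt-*-square (+ 2) (hensel-2 {c = + p} p≡1[8])))
  where
  s : ℤ
  s = + (2 ℕ.* (p ℕ.+ (p ℕ.+ 2)))
  s-4≡4p : + 2 * + 2 * + p ≡ s - + 4
  s-4≡4p = begin
    + 2 * + 2 * + p             ≡⟨ ℤP.*-comm (+ 4) (+ p) ⟩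
    + p * + 4                   ≡⟨ ℤP.pos-* p 4 ⟨
    + (p ℕ.* 4)                 ≡⟨ +[m+n]-m≡n 4 (p ℕ.* 4) ⟨
    + (4 ℕ.+ p ℕ.* 4) - + 4     ≡⟨ cong (λ n → + n - + 4) (double p) ⟩
    s - + 4                     ∎
    where
    open ≡-Reasoning
    double : ∀ p → 4 ℕ.+ p ℕ.* 4 ≡ 2 ℕ.* (p ℕ.+ (p ℕ.+ 2))
    double = ℕ-Solver.solve-∀
  p≡1[8] : + 8 ∣ + p - + 1
  p≡1[8] = divides (+ (p ℕ./ 8)) (begin
    + p - + 1                    ≡⟨ cong (λ n → + n - + 1) (trans (ℕDM.m≡m%n+[m/n]*n p 8) (cong (ℕ._+ p ℕ./ 8 ℕ.* 8) p≡1)) ⟩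
    + (1 ℕ.+ p ℕ./ 8 ℕ.* 8) - + 1 ≡⟨ +[m+n]-m≡n 1 (p ℕ./ 8 ℕ.* 8) ⟩
    + (p ℕ./ 8 ℕ.* 8)            ≡⟨ ℤP.pos-* (p ℕ./ 8) 8 ⟩
    + (p ℕ./ 8) * + 8            ∎)
    where open ≡-Reasoning

twin-mod-8 : ∀ p → ((p ℕ.+ 2) ℕ.% 8 ≡ 1 ⊎ (p ℕ.+ 2) ℕ.% 8 ≡ 3) ⇔ (p ℕ.% 8 ≡ 1 ⊎ p ℕ.% 8 ≡ 7)
twin-mod-8 p = subst (λ r → (r ≡ 1 ⊎ r ≡ 3) ⇔ (p ℕ.% 8 ≡ 1 ⊎ p ℕ.% 8 ≡ 7)) (sym (ℕDM.%-distribˡ-+ p 2 8))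
                     (shift (p ℕ.% 8) (ℕDM.m%n<n p 8))
  where
  shift : ∀ r → r ℕ.< 8 → ((r ℕ.+ 2) ℕ.% 8 ≡ 1 ⊎ (r ℕ.+ 2) ℕ.% 8 ≡ 3) ⇔ (r ≡ 1 ⊎ r ≡ 7)
  shift 1 _ = mk⇔ (λ _ → inj₁ refl) (λ _ → inj₂ refl)
  shift 7 _ = mk⇔ (λ _ → inj₂ refl) (λ _ → inj₁ refl)
  shift 0 _ = mk⇔ (λ { (inj₁ ()) ; (inj₂ ()) }) (λ { (inj₁ ()) ; (inj₂ ()) })
  shift 2 _ = mk⇔ (λ { (inj₁ ()) ; (inj₂ ()) }) (λ { (inj₁ ()) ; (inj₂ ()) })
  shift 3 _ = mk⇔ (λ { (inj₁ ()) ; (inj₂ ()) }) (λ { (inj₁ ()) ; (inj₂ ()) })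
  shift 4 _ = mk⇔ (λ { (inj₁ ()) ; (inj₂ ()) }) (λ { (inj₁ ()) ; (inj₂ ()) })
  shift 5 _ = mk⇔ (λ { (inj₁ ()) ; (inj₂ ()) }) (λ { (inj₁ ()) ; (inj₂ ()) })
  shift 6 _ = mk⇔ (λ { (inj₁ ()) ; (inj₂ ()) }) (λ { (inj₁ ()) ; (inj₂ ()) })
  shift (suc (suc (suc (suc (suc (suc (suc (suc _)))))))) (s≤s (s≤s (s≤s (s≤s (s≤s (s≤s (s≤s (s≤s ()))))))))

2[p+q]≡4+4p : ∀ p → + (2 ℕ.* (p ℕ.+ (p ℕ.+ 2))) ≡ + 4 * + 1 + + 4 * + p
2[p+q]≡4+4p p = begin
  + (2 ℕ.* (p ℕ.+ (p ℕ.+ 2)))  ≡⟨ cong +_ (double p) ⟩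
  + (4 ℕ.+ 4 ℕ.* p)            ≡⟨ ℤP.pos-+ 4 (4 ℕ.* p) ⟩
  + 4 + + (4 ℕ.* p)            ≡⟨ cong (λ x → + 4 + x) (ℤP.pos-* 4 p) ⟩
  + 4 * + 1 + + 4 * + p        ∎
  where
  open ≡-Reasoning
  double : ∀ p → 2 ℕ.* (p ℕ.+ (p ℕ.+ 2)) ≡ 4 ℕ.+ 4 ℕ.* p
  double = ℕ-Solver.solve-∀

2[p+q]≡-4+4q : ∀ p → + (2 ℕ.* (p ℕ.+ (p ℕ.+ 2))) ≡ + 4 * - (+ 1) + + 4 * + (p ℕ.+ 2)
2[p+q]≡-4+4q p = begin
  + (2 ℕ.* (p ℕ.+ (p ℕ.+ 2)))        ≡⟨ 2[p+q]≡4+4p p ⟩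
  + 4 * + 1 + + 4 * + p              ≡⟨ shift (+ p) ⟩
  + 4 * - (+ 1) + + 4 * (+ p + + 2)  ≡⟨ cong (λ x → + 4 * - (+ 1) + + 4 * x) (ℤP.pos-+ p 2) ⟨
  + 4 * - (+ 1) + + 4 * + (p ℕ.+ 2)  ∎
  where
  open ≡-Reasoning
  shift : ∀ x → + 4 * + 1 + + 4 * x ≡ + 4 * - (+ 1) + + 4 * (x + + 2)
  shift = solve-∀

proposition3p7 : (p q : ℕ) → Prime p → Prime q → q ≡ p ℕ.+ 2 →
    ((p ℕ.% 8 ≡ 1) → HasQvPoint (+ (2 ℕ.* (p ℕ.+ q))) 2)
    × ((HasQvPoint (+ (2 ℕ.* (p ℕ.+ q))) p ⇔ LegendreOne -[1+ 1 ] p)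
    × (LegendreOne -[1+ 1 ] p ⇔ (p ℕ.% 8 ≡ 1 ⊎ p ℕ.% 8 ≡ 3)))
    × ((HasQvPoint (+ (2 ℕ.* (p ℕ.+ q))) q ⇔ LegendreOne -[1+ 1 ] q)
    × (LegendreOne -[1+ 1 ] q ⇔ (q ℕ.% 8 ≡ 1 ⊎ q ℕ.% 8 ≡ 3))
    × ((q ℕ.% 8 ≡ 1 ⊎ q ℕ.% 8 ≡ 3) ⇔ (p ℕ.% 8 ≡ 1 ⊎ p ℕ.% 8 ≡ 7)))
proposition3p7 p .(p ℕ.+ 2) p-prime q-prime refl =
    point-over-ℚ₂ p
  , ( subst (λ s → HasQvPoint s p ⇔ LegendreOne -[1+ 1 ] p) (sym (2[p+q]≡4+4p p))
              (local-solubility p-prime p≢2 {+ 1} refl)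
    , -2-residue⇔ p-prime p≢2 )
  , ( subst (λ s → HasQvPoint s (p ℕ.+ 2) ⇔ LegendreOne -[1+ 1 ] (p ℕ.+ 2)) (sym (2[p+q]≡-4+4q p))
              (local-solubility q-prime q≢2 {ε = - (+ 1)} refl)
    , -2-residue⇔ q-prime q≢2
    , twin-mod-8 p )
  where
  p≢2 : p ≢ 2
  p≢2 refl = composite⇒¬prime composite[4] q-prime
  q≢2 : p ℕ.+ 2 ≢ 2
  q≢2 p+2≡2 = ℕP.<⇒≢ (ℕP.<-trans (s≤s z≤n) (prime>1 p-prime)) (sym (ℕP.+-cancelʳ-≡ 2 p 0 p+2≡2))
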